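{- Let $a,b,c$ be positive reals (or indeterminates) and for $n\geq1$ let $\Gamma_n$ be the Sierpiński graph with the Schreier labelling and $T_n,U_n,R_n,L_n,Q_n$ its weighted generating functions, as defined in the context. Then for every $n\geq1$: $$T_{n+1}=2T_n^2(U_n+R_n+L_n),$$ $$U_{n+1}=T_n(3L_nR_n+U_nR_n+U_nL_n+2U_n^2)+T_n^2Q_n,$$ $$R_{n+1}=T_n(3U_nL_n+U_nR_n+R_nL_n+2R_n^2)+T_n^2Q_n,$$ $$L_{n+1}=T_n(3U_nR_n+L_nU_n+R_nL_n+2L_n^2)+T_n^2Q_n,$$ $$Q_{n+1}=4T_nQ_n(U_n+R_n+L_n)+2\big(U_n^2(L_n+R_n)+R_n^2(U_n+L_n)+L_n^2(R_n+U_n)\big)+2U_nR_nL_n,$$ with $T_1=ab+ac+bc$, $U_1=b$, $R_1=a$, $L_1=c$, $Q_1=1$.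
   Context: Graphs $\Gamma_n$ with Schreier labelling: $\Gamma_1$ is an equilateral triangle with a horizontal base, whose left side is labelled $a$, base labelled $b$ and right side labelled $c$. For $n\geq1$, $\Gamma_{n+1}$ is formed from three copies of $\Gamma_n$ placed at the top, bottom-left and bottom-right corners of a larger equilateral triangle, glued Sierpiński-style (the bottom-left corner of the top copy identified with the top corner of the bottom-left copy, the bottom-right corner of the top copy with the top corner of the bottom-right copy, the bottom-right corner of the bottom-left copy with the bottom-left corner of the bottom-right copy), where the copy at each corner is the mirror image of $\Gamma_n$ (with its labels) in the bisector of the angle of $\Gamma_n$ at that corner (vertical axis for the top copy, bisector of the bottom-left angle for the bottom-left copy, bisector of the bottom-right angle for the bottom-right copy). The outmost vertices are the top, leftmost (bottom-left) and rightmost (bottom-right) corners. Weights: an edge labelled $w$ has weight $w$; a spanning subgraph has weight the product of the weights of its edges. $T_n$ = sum of weights of spanning trees of $\Gamma_n$. $U_n$ = sum of weights of two-component spanning forests in which the leftmost and rightmost vertices lie in one component and the top vertex in the other; $R_n$ = same with the rightmost vertex alone in its component; $L_n$ = same with the leftmost vertex alone in its component. $Q_n$ = sum of weights of three-component spanning forests in which the three outmost vertices lie in different components. -}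

module Defs where

open import Level using (Level)
open import Data.Nat using (ℕ; zero; suc; _≡ᵇ_)
import Data.Nat as ℕ
open import Data.Bool using (Bool; true; false; _∧_; _∨_; not; if_then_else_)
open import Data.List using (List; []; _∷_; _++_; map; filter; length; foldr; upTo)
open import Data.Product using (_×_; _,_)
open import Relation.Nullary.Decidable using (Dec)
open import Data.Bool.Properties using (T?)
open import Algebra.Bundles using (CommutativeSemiring)
import Algebra.Definitions.RawSemiring as RSD

data Label : Set where
  la lb lc : Label

-- A (multi)graph on the vertex set {0, …, nv-1} given by a list of
-- labelled edges (x , y , label).
Edge : Set
Edge = ℕ × ℕ × Label

record Graph : Set where
  constructor graph
  field
    nv    : ℕ
    edges : List Edge
open Graph public

-- Convention: in every Γ n the outmost vertices are numbered
--   0 = top, 1 = leftmost (bottom-left), 2 = rightmost (bottom-right).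
top left right : ℕ
top = 0
left = 1
right = 2

Γ₁ : Graph
Γ₁ = graph 3 ((top , left , la) ∷ (left , right , lb) ∷ (right , top , lc) ∷ [])

mapEdge : (ℕ → ℕ) → Edge → Edge
mapEdge f (x , y , l) = (f x , y' , l) where y' = f y

-- Γ (n+1) is built from three copies X (top), Y (bottom-left),
-- Z (bottom-right) of Γ n.  Each copy is the mirror image of Γ n in the
-- bisector of the angle at its corner, so its corner vertices are those of
-- Γ n permuted:
--   X: top ↦ top,  Γn-left ↦ X's bottom-right,  Γn-right ↦ X's bottom-left
--   Y: left ↦ left, Γn-top ↦ Y's bottom-right,   Γn-right ↦ Y's top
--   Z: right ↦ right, Γn-top ↦ Z's bottom-left,  Γn-left ↦ Z's top
-- Gluing: X-bottom-left = Y-top =: vertex 3,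
--         X-bottom-right = Z-top =: vertex 4,
--         Y-bottom-right = Z-bottom-left =: vertex 5.
-- Non-corner vertices (≥ 3) of Γ n, k = nv - 3 of them, are sent to
--   X: 6 + (v-3),  Y: 6 + k + (v-3),  Z: 6 + 2k + (v-3).
embX embY embZ : ℕ → ℕ → ℕ
embX k 0 = 0
embX k 1 = 4
embX k 2 = 3
embX k (suc (suc (suc v))) = 6 ℕ.+ v
embY k 0 = 5
embY k 1 = 1
embY k 2 = 3
embY k (suc (suc (suc v))) = 6 ℕ.+ k ℕ.+ v
embZ k 0 = 5
embZ k 1 = 4
embZ k 2 = 2
embZ k (suc (suc (suc v))) = 6 ℕ.+ k ℕ.+ k ℕ.+ v

step : Graph → Graph
step (graph n es) =
  graph (3 ℕ.* n ℕ.∸ 3)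
        (map (mapEdge (embX k)) es ++ map (mapEdge (embY k)) es ++ map (mapEdge (embZ k)) es)
  where k = n ℕ.∸ 3

Γ : ℕ → Graph
Γ zero = Γ₁      -- (unused index 0 is set equal to Γ₁; all statements use n ≥ 1)
Γ (suc zero) = Γ₁
Γ (suc (suc m)) = step (Γ (suc m))

-- all spanning subgraphs = all sub-lists of the edge list (by position)
subsets : {A : Set} → List A → List (List A)
subsets [] = [] ∷ []
subsets (x ∷ xs) = let s = subsets xs in s ++ map (x ∷_) s

picks : {A : Set} → List A → List (A × List A)
picks [] = []
picks (x ∷ xs) = (x , xs) ∷ map (λ { (y , ys) → (y , x ∷ ys) }) (picks xs)

anyB : {A : Set} → (A → Bool) → List A → Bool
anyB p = foldr (λ x r → p x ∨ r) false

allB : {A : Set} → (A → Bool) → List A → Bool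
allB p = foldr (λ x r → p x ∧ r) true

reachIn : ℕ → List Edge → ℕ → ℕ → Bool
reachIn zero F u v = u ≡ᵇ v
reachIn (suc k) F u v =
  reachIn k F u v ∨
  anyB (λ { (x , y , _) → (reachIn k F u x ∧ (y ≡ᵇ v)) ∨ (reachIn k F u y ∧ (x ≡ᵇ v)) }) F

-- u and v lie in the same connected component of the subgraph F
-- (a path uses at most length F edges)
conn : List Edge → ℕ → ℕ → Bool
conn F u v = reachIn (length F) F u v

-- F is acyclic (a forest): every edge of F is a bridge, i.e. its endpoints
-- are disconnected after removing it (this also excludes loops).
isForest : List Edge → Bool
isForest F = allB (λ { ((x , y , _) , rest) → not (conn rest x y) }) (picks F)

countB : {A : Set} → (A → Bool) → List A → ℕ
countB p = foldr (λ x r → if p x then suc r else r) 0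

-- number of connected components of the spanning subgraph F of a graph
-- with vertex set {0..nv-1}: count vertices that are the least in their
-- component
components : ℕ → List Edge → ℕ
components nv F = countB (λ v → not (anyB (λ u → conn F u v) (upTo v))) (upTo nv)

module Gen {c ℓ : Level} (S : CommutativeSemiring c ℓ) where
  open CommutativeSemiring S

  infixr 8 _·_
  _·_ : ℕ → Carrier → Carrier
  _·_ = RSD._×_ rawSemiring

  module _ (a b c' : Carrier) where

    wLabel : Label → Carrier
    wLabel la = a
    wLabel lb = b
    wLabel lc = c'

    weight : List Edge → Carrier
    weight F = foldr (λ { (_ , _ , l) r → wLabel l * r }) 1# F

    wsum : Graph → (List Edge → Bool) → Carrier
    wsum G p = foldr (λ F r → (if p F then weight F else 0#) + r) 0# (subsets (edges G))

    forestWith : Graph → ℕ → (List Edge → Bool) → List Edge → Bool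
    forestWith G k q F = isForest F ∧ (components (nv G) F ≡ᵇ k) ∧ q F

    Tg Ug Rg Lg Qg : Graph → Carrier
    Tg G = wsum G (forestWith G 1 (λ _ → true))
    Ug G = wsum G (forestWith G 2 (λ F → conn F left right ∧ not (conn F top left)))
    Rg G = wsum G (forestWith G 2 (λ F → conn F top left ∧ not (conn F top right)))
    Lg G = wsum G (forestWith G 2 (λ F → conn F top right ∧ not (conn F top left)))
    Qg G = wsum G (forestWith G 3 (λ F → not (conn F top left) ∧ not (conn F top right)
                                           ∧ not (conn F left right)))

    T U R L Q : ℕ → Carrier
    T n = Tg (Γ n)
    U n = Ug (Γ n)
    R n = Rg (Γ n)
    L n = Lg (Γ n)
    Q n = Qg (Γ n)

module Submission where

-- Gluing only identifies the six corner vertices, so Euler's formula (components + edges =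
-- vertices) shows that a forest of Γ (n + 1) counted by T, U, R, L or Q restricts to forests
-- of the copies each of whose components contains a corner, i.e. to forests counted by
-- T, U, R, L or Q of Γ n; conversely such pieces glue to a counted forest exactly when the
-- corner links they induce on the six gluing vertices are acyclic and realise the required
-- corner connections.  That condition depends only on the kinds of the three pieces and is
-- decided by a finite union–find computation, so the weighted count factors over the copies
-- and each recurrence is a finite sum over triples of kinds, evaluated by normalising
-- polynomials in T n, U n, R n, L n, Q n.

open import Defs
open import Level using (Level)
open import Data.Nat using (ℕ; suc)
open import Data.Product using (_×_; _,_)
open import Algebra.Bundles using (CommutativeSemiring)

module Booleans where

  open import Data.Nat using (zero; suc; _≡ᵇ_)
  open import Data.Nat.Properties using (≡ᵇ⇒≡)
  open import Data.Bool using (Bool; true; false; _∧_; _∨_; not; T)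
  open import Data.List using ([]; _∷_; map)
  open import Data.List.Membership.Propositional using (_∈_)
  open import Data.List.Relation.Unary.Any using (here; there)
  open import Data.Product using (_×_; _,_; ∃; proj₁; proj₂)
  open import Data.Sum using (_⊎_; inj₁; inj₂)
  open import Relation.Nullary using (contradiction)
  open import Relation.Binary.PropositionalEquality

  Bool-ext : ∀ {a b} → (a ≡ true → b ≡ true) → (b ≡ true → a ≡ true) → a ≡ b
  Bool-ext {true} {true} _ _ = refl
  Bool-ext {true} {false} f _ = sym (f refl)
  Bool-ext {false} {true} _ g = g refl
  Bool-ext {false} {false} _ _ = refl

  false≢true : false ≢ true
  false≢true ()

  not-true⁻ : ∀ {a} → not a ≡ true → a ≡ false
  not-true⁻ {false} _ = refl

  ∧-true⁻ : ∀ {a b} → a ∧ b ≡ true → a ≡ true × b ≡ true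
  ∧-true⁻ {true} {true} _ = refl , refl

  ∧-true⁺ : ∀ {a b} → a ≡ true → b ≡ true → a ∧ b ≡ true
  ∧-true⁺ refl refl = refl

  ∧-not-true⁺ : ∀ {a b} → a ≡ true → b ≡ false → a ∧ not b ≡ true
  ∧-not-true⁺ refl refl = refl

  ∨-true⁻ : ∀ {a b} → a ∨ b ≡ true → a ≡ true ⊎ b ≡ true
  ∨-true⁻ {true} _ = inj₁ refl
  ∨-true⁻ {false} p = inj₂ p

  ∨-true⁺ˡ : ∀ {a} b → a ≡ true → a ∨ b ≡ true
  ∨-true⁺ˡ _ refl = refl

  ∨-true⁺ʳ : ∀ a {b} → b ≡ true → a ∨ b ≡ true
  ∨-true⁺ʳ true _ = refl
  ∨-true⁺ʳ false p = p

  infixr 5 _⇒ᵇ_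

  _⇒ᵇ_ : Bool → Bool → Bool
  a ⇒ᵇ b = not a ∨ b

  ⇒ᵇ-true⁺ : ∀ {a b} → (a ≡ true → b ≡ true) → (a ⇒ᵇ b) ≡ true
  ⇒ᵇ-true⁺ {true} f = f refl
  ⇒ᵇ-true⁺ {false} _ = refl

  ⇒ᵇ-true⁻ : ∀ {a b} → (a ⇒ᵇ b) ≡ true → a ≡ true → b ≡ true
  ⇒ᵇ-true⁻ {true} h refl = h

  _==_ : Bool → Bool → Bool
  true == b = b
  false == b = not b

  ==-true⁻ : ∀ {a b} → (a == b) ≡ true → a ≡ b
  ==-true⁻ {true} {true} _ = refl
  ==-true⁻ {false} {false} _ = refl

  ≡ᵇ-true⁻ : ∀ {m n} → (m ≡ᵇ n) ≡ true → m ≡ n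
  ≡ᵇ-true⁻ {m} {n} p = ≡ᵇ⇒≡ m n (subst T (sym p) _)

  ≡ᵇ-refl : ∀ n → (n ≡ᵇ n) ≡ true
  ≡ᵇ-refl zero = refl
  ≡ᵇ-refl (suc n) = ≡ᵇ-refl n

  ≡ᵇ-false⁺ : ∀ {m n} → m ≢ n → (m ≡ᵇ n) ≡ false
  ≡ᵇ-false⁺ {m} {n} m≢n with m ≡ᵇ n in eq
  ... | true = contradiction (≡ᵇ-true⁻ eq) m≢n
  ... | false = refl

  module _ {A : Set} where

    anyB-true⁻ : ∀ (p : A → Bool) xs → anyB p xs ≡ true → ∃ λ x → x ∈ xs × p x ≡ true
    anyB-true⁻ p (x ∷ xs) h with ∨-true⁻ {p x} h
    ... | inj₁ px = x , here refl , px
    ... | inj₂ rest with anyB-true⁻ p xs rest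
    ... | y , y∈xs , py = y , there y∈xs , py

    anyB-true⁺ : ∀ (p : A → Bool) {x} xs → x ∈ xs → p x ≡ true → anyB p xs ≡ true
    anyB-true⁺ p (y ∷ xs) (here refl) px = ∨-true⁺ˡ (anyB p xs) px
    anyB-true⁺ p (y ∷ xs) (there x∈xs) px = ∨-true⁺ʳ (p y) (anyB-true⁺ p xs x∈xs px)

    allB-true⁻ : ∀ (p : A → Bool) xs → allB p xs ≡ true → ∀ {x} → x ∈ xs → p x ≡ true
    allB-true⁻ p (y ∷ xs) h (here refl) = proj₁ (∧-true⁻ {p y} h)
    allB-true⁻ p (y ∷ xs) h (there x∈xs) = allB-true⁻ p xs (proj₂ (∧-true⁻ {p y} h)) x∈xs

    allB-true⁺ : ∀ (p : A → Bool) xs → (∀ {x} → x ∈ xs → p x ≡ true) → allB p xs ≡ true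
    allB-true⁺ p [] h = refl
    allB-true⁺ p (x ∷ xs) h = ∧-true⁺ (h (here refl)) (allB-true⁺ p xs (λ x∈xs → h (there x∈xs)))

    allB-cong : ∀ (p q : A → Bool) xs → (∀ {x} → x ∈ xs → p x ≡ q x) → allB p xs ≡ allB q xs
    allB-cong p q [] h = refl
    allB-cong p q (x ∷ xs) h = cong₂ _∧_ (h (here refl)) (allB-cong p q xs (λ x∈xs → h (there x∈xs)))

  allB-map : ∀ {A B : Set} (p : B → Bool) (f : A → B) xs → allB p (map f xs) ≡ allB (λ x → p (f x)) xs
  allB-map p f [] = refl
  allB-map p f (x ∷ xs) = cong (p (f x) ∧_) (allB-map p f xs)

module Walks where

  open Booleans
  open import Data.Nat using (ℕ; zero; suc; _≡ᵇ_; _≤_; z≤n; s≤s)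
  open import Data.Nat.Properties using (_≟_)
  open import Data.Bool using (true; _∧_; _∨_)
  open import Data.List using (List; []; _∷_; map; length; lookup; allFin)
  open import Data.List.Properties using (length-tabulate)
  open import Data.List.Membership.Propositional using (_∈_)
  open import Data.List.Membership.Propositional.Properties using (∈-allFin; ∈-map⁺)
  open import Data.List.Membership.DecPropositional _≟_ using (_∈?_)
  open import Data.List.Relation.Unary.Any using (here; there; index)
  open import Data.List.Relation.Unary.Any.Properties using (lookup-index)
  open import Data.List.Relation.Unary.All using ([]; _∷_)
  open import Data.List.Relation.Unary.All.Properties using (¬Any⇒All¬; All¬⇒¬Any)
  open import Data.List.Relation.Binary.Subset.Propositional using (_⊆_)
  open import Data.List.Relation.Unary.AllPairs using ([]; _∷_)
  open import Data.List.Relation.Unary.Unique.Propositional using (Unique)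
  open import Data.Fin using (Fin)
  open import Data.Product using (_,_; Σ; proj₁)
  open import Data.Sum using (inj₁; inj₂)
  open import Relation.Nullary using (yes; no; contradiction)
  open import Relation.Binary.PropositionalEquality

  data Step (F : List Edge) (u v : ℕ) : Set where
    fwd : ∀ {l} → (u , v , l) ∈ F → Step F u v
    bwd : ∀ {l} → (v , u , l) ∈ F → Step F u v

  data Walk (F : List Edge) (u : ℕ) : ℕ → Set where
    nil : Walk F u u
    snoc : ∀ {w v} → Walk F u w → Step F w v → Walk F u v

  module _ {F : List Edge} where

    walkLength : ∀ {u v} → Walk F u v → ℕ
    walkLength nil = 0
    walkLength (snoc w _) = suc (walkLength w)

    step-reverse : ∀ {u v} → Step F u v → Step F v u
    step-reverse (fwd e) = bwd e
    step-reverse (bwd e) = fwd e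

    infixl 5 _++ʷ_

    _++ʷ_ : ∀ {u w v} → Walk F u w → Walk F w v → Walk F u v
    w ++ʷ nil = w
    w ++ʷ snoc w′ s = snoc (w ++ʷ w′) s

    walk-reverse : ∀ {u v} → Walk F u v → Walk F v u
    walk-reverse nil = nil
    walk-reverse (snoc w s) = snoc nil (step-reverse s) ++ʷ walk-reverse w

    edge-walk : ∀ {x y l} → (x , y , l) ∈ F → Walk F x y
    edge-walk e = snoc nil (fwd e)

  walk-mono : ∀ {F G u v} → F ⊆ G → Walk F u v → Walk G u v
  walk-mono F⊆G nil = nil
  walk-mono F⊆G (snoc w (fwd e)) = snoc (walk-mono F⊆G w) (fwd (F⊆G e))
  walk-mono F⊆G (snoc w (bwd e)) = snoc (walk-mono F⊆G w) (bwd (F⊆G e))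

  walk-map : ∀ {F u v} (f : ℕ → ℕ) → Walk F u v → Walk (map (mapEdge f) F) (f u) (f v)
  walk-map f nil = nil
  walk-map f (snoc w (fwd e)) = snoc (walk-map f w) (fwd (∈-map⁺ (mapEdge f) e))
  walk-map f (snoc w (bwd e)) = snoc (walk-map f w) (bwd (∈-map⁺ (mapEdge f) e))

  reachIn⇒Walk : ∀ k F u v → reachIn k F u v ≡ true → Walk F u v
  reachIn⇒Walk zero F u v h with ≡ᵇ-true⁻ {u} {v} h
  ... | refl = nil
  reachIn⇒Walk (suc k) F u v h with ∨-true⁻ {reachIn k F u v} h
  ... | inj₁ shorter = reachIn⇒Walk k F u v shorter
  ... | inj₂ viaEdge with anyB-true⁻ _ F viaEdge
  ... | (x , y , l) , e , last with ∨-true⁻ {reachIn k F u x ∧ (y ≡ᵇ v)} last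
  ... | inj₁ forward with ∧-true⁻ {reachIn k F u x} forward
  ... | ux , yv with ≡ᵇ-true⁻ {y} yv
  ... | refl = snoc (reachIn⇒Walk k F u x ux) (fwd e)
  reachIn⇒Walk (suc k) F u v h | inj₂ _ | (x , y , l) , e , _ | inj₂ backward
    with ∧-true⁻ {reachIn k F u y} backward
  ... | uy , xv with ≡ᵇ-true⁻ {x} xv
  ... | refl = snoc (reachIn⇒Walk k F u y uy) (bwd e)

  Walk⇒reachIn : ∀ {F u v} (w : Walk F u v) → reachIn (walkLength w) F u v ≡ true
  Walk⇒reachIn {u = u} nil = ≡ᵇ-refl u
  Walk⇒reachIn {F} {v = v} (snoc w (fwd e)) =
    ∨-true⁺ʳ _ (anyB-true⁺ _ F e (∨-true⁺ˡ _ (∧-true⁺ (Walk⇒reachIn w) (≡ᵇ-refl v))))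
  Walk⇒reachIn {F} {v = v} (snoc w (bwd e)) =
    ∨-true⁺ʳ _ (anyB-true⁺ _ F e (∨-true⁺ʳ _ (∧-true⁺ (Walk⇒reachIn w) (≡ᵇ-refl v))))

  reachIn-mono : ∀ {k k′} F u v → k ≤ k′ → reachIn k F u v ≡ true → reachIn k′ F u v ≡ true
  reachIn-mono {zero} {zero} F u v z≤n h = h
  reachIn-mono {zero} {suc k′} F u v z≤n h = ∨-true⁺ˡ _ (reachIn-mono {k′ = k′} F u v z≤n h)
  reachIn-mono {suc k} {suc k′} F u v (s≤s k≤k′) h with ∨-true⁻ {reachIn k F u v} h
  ... | inj₁ shorter = ∨-true⁺ˡ _ (reachIn-mono F u v k≤k′ shorter)
  ... | inj₂ viaEdge with anyB-true⁻ _ F viaEdge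
  ... | (x , y , l) , e , last = ∨-true⁺ʳ (reachIn k′ F u v) (anyB-true⁺ _ F e (lift last))
    where
    lift : (reachIn k F u x ∧ (y ≡ᵇ v)) ∨ (reachIn k F u y ∧ (x ≡ᵇ v)) ≡ true →
           (reachIn k′ F u x ∧ (y ≡ᵇ v)) ∨ (reachIn k′ F u y ∧ (x ≡ᵇ v)) ≡ true
    lift h′ with ∨-true⁻ {reachIn k F u x ∧ (y ≡ᵇ v)} h′
    ... | inj₁ fw with ∧-true⁻ {reachIn k F u x} fw
    ... | ux , yv = ∨-true⁺ˡ _ (∧-true⁺ (reachIn-mono F u x k≤k′ ux) yv)
    lift h′ | inj₂ bw with ∧-true⁻ {reachIn k F u y} bw
    ... | uy , xv = ∨-true⁺ʳ _ (∧-true⁺ (reachIn-mono F u y k≤k′ uy) xv)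

  -- Loop erasure: a path uses pairwise distinct edges, so it has at most length F steps,
  -- which is all that conn explores.

  vertices : ∀ {F u v} → Walk F u v → List ℕ
  vertices {u = u} nil = u ∷ []
  vertices {v = v} (snoc w _) = v ∷ vertices w

  Path : List Edge → ℕ → ℕ → Set
  Path F u v = Σ (Walk F u v) (λ w → Unique (vertices w))

  path-prefix : ∀ {F u x v} (p : Path F u x) → v ∈ vertices (proj₁ p) → Path F u v
  path-prefix (nil , uq) (here refl) = nil , uq
  path-prefix (snoc w s , uq) (here refl) = snoc w s , uq
  path-prefix (snoc w s , _ ∷ uq) (there v∈) = path-prefix (w , uq) v∈

  loop-erase : ∀ {F u v} → Walk F u v → Path F u v
  loop-erase nil = nil , [] ∷ []
  loop-erase {v = v} (snoc w s) with loop-erase w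
  ... | w′ , uq with v ∈? vertices w′
  ... | yes v∈ = path-prefix (w′ , uq) v∈
  ... | no v∉ = snoc w′ s , ¬Any⇒All¬ (vertices w′) v∉ ∷ uq

  endpoints : Edge → List ℕ
  endpoints (x , y , _) = x ∷ y ∷ []

  module _ {F : List Edge} where

    stepEdge : ∀ {u v} → Step F u v → Fin (length F)
    stepEdge (fwd e) = index e
    stepEdge (bwd e) = index e

    edgeIndices : ∀ {u v} → Walk F u v → List (Fin (length F))
    edgeIndices nil = []
    edgeIndices (snoc w s) = stepEdge s ∷ edgeIndices w

    last∈vertices : ∀ {u v} (w : Walk F u v) → v ∈ vertices w
    last∈vertices nil = here refl
    last∈vertices (snoc _ _) = here refl

    step-target∈ : ∀ {u v} (s : Step F u v) → v ∈ endpoints (lookup F (stepEdge s))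
    step-target∈ (fwd e) rewrite sym (lookup-index e) = there (here refl)
    step-target∈ (bwd e) rewrite sym (lookup-index e) = here refl

    edgeIndices-endpoints : ∀ {u v} (w : Walk F u v) {i} → i ∈ edgeIndices w →
                            ∀ {z} → z ∈ endpoints (lookup F i) → z ∈ vertices w
    edgeIndices-endpoints (snoc w (fwd e)) (here refl) z∈ rewrite sym (lookup-index e) with z∈
    ... | here refl = there (last∈vertices w)
    ... | there (here refl) = here refl
    edgeIndices-endpoints (snoc w (bwd e)) (here refl) z∈ rewrite sym (lookup-index e) with z∈
    ... | here refl = here refl
    ... | there (here refl) = there (last∈vertices w)
    edgeIndices-endpoints (snoc w _) (there i∈) z∈ = there (edgeIndices-endpoints w i∈ z∈)

    path-edgeIndices-unique : ∀ {u v} (w : Walk F u v) → Unique (vertices w) → Unique (edgeIndices w)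
    path-edgeIndices-unique nil _ = []
    path-edgeIndices-unique {v = v} (snoc w s) (v-new ∷ uq) =
      ¬Any⇒All¬ (edgeIndices w) (λ i∈ → All¬⇒¬Any v-new (edgeIndices-endpoints w i∈ (step-target∈ s)))
      ∷ path-edgeIndices-unique w uq

    edgeIndices-length : ∀ {u v} (w : Walk F u v) → length (edgeIndices w) ≡ walkLength w
    edgeIndices-length nil = refl
    edgeIndices-length (snoc w _) = cong suc (edgeIndices-length w)

  remove : ∀ {A : Set} {x : A} (ys : List A) → x ∈ ys → List A
  remove (y ∷ ys) (here _) = ys
  remove (y ∷ ys) (there x∈) = y ∷ remove ys x∈

  length-remove : ∀ {A : Set} {x : A} (ys : List A) (x∈ : x ∈ ys) → suc (length (remove ys x∈)) ≡ length ys
  length-remove (y ∷ ys) (here _) = refl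
  length-remove (y ∷ ys) (there x∈) = cong suc (length-remove ys x∈)

  ∈-remove : ∀ {A : Set} {x z : A} (ys : List A) (x∈ : x ∈ ys) → z ∈ ys → z ≢ x → z ∈ remove ys x∈
  ∈-remove (y ∷ ys) (here refl) (here refl) z≢x = contradiction refl z≢x
  ∈-remove (y ∷ ys) (here _) (there z∈) _ = z∈
  ∈-remove (y ∷ ys) (there x∈) (here refl) _ = here refl
  ∈-remove (y ∷ ys) (there x∈) (there z∈) z≢x = there (∈-remove ys x∈ z∈ z≢x)

  Unique⇒length≤ : ∀ {A : Set} (xs ys : List A) → Unique xs → (∀ {z} → z ∈ xs → z ∈ ys) → length xs ≤ length ys
  Unique⇒length≤ [] ys _ _ = z≤n
  Unique⇒length≤ (x ∷ xs) ys (x-new ∷ uq) xs⊆ys =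
    subst (suc (length xs) ≤_) (length-remove ys x∈ys)
      (s≤s (Unique⇒length≤ xs (remove ys x∈ys) uq
        (λ z∈ → ∈-remove ys x∈ys (xs⊆ys (there z∈)) (λ { refl → All¬⇒¬Any x-new z∈ }))))
    where x∈ys = xs⊆ys (here refl)

  path-length≤ : ∀ {F u v} (w : Walk F u v) → Unique (vertices w) → walkLength w ≤ length F
  path-length≤ {F} w uq =
    subst₂ _≤_ (edgeIndices-length w) (length-tabulate {n = length F} (λ i → i))
      (Unique⇒length≤ (edgeIndices w) (allFin (length F)) (path-edgeIndices-unique w uq) (λ {i} _ → ∈-allFin i))

  conn⇒Walk : ∀ {F u v} → conn F u v ≡ true → Walk F u v
  conn⇒Walk {F} {u} {v} = reachIn⇒Walk (length F) F u v

  Walk⇒conn : ∀ {F u v} → Walk F u v → conn F u v ≡ true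
  Walk⇒conn {F} {u} {v} w with loop-erase w
  ... | p , uq = reachIn-mono F u v (path-length≤ p uq) (Walk⇒reachIn p)

  conn-sym : ∀ F u v → conn F u v ≡ conn F v u
  conn-sym F u v = Bool-ext (λ c → Walk⇒conn (walk-reverse (conn⇒Walk {F} c)))
                            (λ c → Walk⇒conn (walk-reverse (conn⇒Walk {F} c)))

module Forests where

  open Booleans
  open Walks
  open import Data.Nat using (ℕ)
  open import Data.Bool using (Bool; true; false; _∧_; _∨_; not)
  open import Data.Bool.Properties using (∧-zeroʳ; ∧-identityʳ)
  open import Data.List using (List; _∷_)
  open import Data.List.Membership.Propositional using (_∈_)
  open import Data.List.Membership.Propositional.Properties using (∈-map⁻)
  open import Data.List.Relation.Unary.Any using (here; there)
  open import Data.Product using (_×_; _,_; proj₁; proj₂)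
  open import Data.Sum using (_⊎_; inj₁; inj₂)
  open import Relation.Nullary using (contradiction)
  open import Relation.Binary.PropositionalEquality

  WalkAround : List Edge → ℕ → ℕ → ℕ → ℕ → Set
  WalkAround G x y u v = Walk G u v ⊎ (Walk G u x × Walk G y v) ⊎ (Walk G u y × Walk G x v)

  WalkAround-swap : ∀ {G x y u v} → WalkAround G x y u v → WalkAround G y x u v
  WalkAround-swap (inj₁ w) = inj₁ w
  WalkAround-swap (inj₂ (inj₁ p)) = inj₂ (inj₂ p)
  WalkAround-swap (inj₂ (inj₂ p)) = inj₂ (inj₁ p)

  -- A walk through a new edge x—y can be shortcut so that it crosses the edge at most once.
  walk-∷-split : ∀ {G x y l u v} → Walk ((x , y , l) ∷ G) u v → WalkAround G x y u v
  walk-∷-split nil = inj₁ nil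
  walk-∷-split {G} {x} {y} {l} {u} (snoc w s) = extend (walk-∷-split w) s
    where
    extend : ∀ {a b} → WalkAround G x y u a → Step ((x , y , l) ∷ G) a b → WalkAround G x y u b
    extend (inj₁ p) (fwd (there e)) = inj₁ (snoc p (fwd e))
    extend (inj₁ p) (bwd (there e)) = inj₁ (snoc p (bwd e))
    extend (inj₂ (inj₁ (p , q))) (fwd (there e)) = inj₂ (inj₁ (p , snoc q (fwd e)))
    extend (inj₂ (inj₁ (p , q))) (bwd (there e)) = inj₂ (inj₁ (p , snoc q (bwd e)))
    extend (inj₂ (inj₂ (p , q))) (fwd (there e)) = inj₂ (inj₂ (p , snoc q (fwd e)))
    extend (inj₂ (inj₂ (p , q))) (bwd (there e)) = inj₂ (inj₂ (p , snoc q (bwd e)))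
    extend (inj₁ p) (fwd (here refl)) = inj₂ (inj₁ (p , nil))
    extend (inj₁ p) (bwd (here refl)) = inj₂ (inj₂ (p , nil))
    extend (inj₂ (inj₁ (p , q))) (fwd (here refl)) = inj₂ (inj₁ (p , nil))
    extend (inj₂ (inj₁ (p , q))) (bwd (here refl)) = inj₁ p
    extend (inj₂ (inj₂ (p , q))) (fwd (here refl)) = inj₁ p
    extend (inj₂ (inj₂ (p , q))) (bwd (here refl)) = inj₂ (inj₂ (p , nil))

  conn-∷ : ∀ G x y l p q →
    conn ((x , y , l) ∷ G) p q ≡ (conn G p q ∨ (conn G p x ∧ conn G y q) ∨ (conn G p y ∧ conn G x q))
  conn-∷ G x y l p q = Bool-ext to from
    where
    G′ = (x , y , l) ∷ G
    viaEdge = conn G p q ∨ (conn G p x ∧ conn G y q) ∨ (conn G p y ∧ conn G x q)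
    xy : Walk G′ x y
    xy = edge-walk (here refl)
    lift : ∀ {a b} → conn G a b ≡ true → Walk G′ a b
    lift c = walk-mono there (conn⇒Walk c)
    to : conn G′ p q ≡ true → viaEdge ≡ true
    to c with walk-∷-split (conn⇒Walk {G′} c)
    ... | inj₁ w = ∨-true⁺ˡ _ (Walk⇒conn w)
    ... | inj₂ (inj₁ (px , yq)) = ∨-true⁺ʳ (conn G p q) (∨-true⁺ˡ _ (∧-true⁺ (Walk⇒conn px) (Walk⇒conn yq)))
    ... | inj₂ (inj₂ (py , xq)) = ∨-true⁺ʳ (conn G p q) (∨-true⁺ʳ _ (∧-true⁺ (Walk⇒conn py) (Walk⇒conn xq)))
    from : viaEdge ≡ true → conn G′ p q ≡ true
    from c with ∨-true⁻ {conn G p q} c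
    ... | inj₁ pq = Walk⇒conn (lift pq)
    ... | inj₂ c′ with ∨-true⁻ {conn G p x ∧ conn G y q} c′
    ... | inj₁ viaXY with ∧-true⁻ {conn G p x} viaXY
    ... | px , yq = Walk⇒conn (lift px ++ʷ xy ++ʷ lift yq)
    from c | inj₂ c′ | inj₂ viaYX with ∧-true⁻ {conn G p y} viaYX
    ... | py , xq = Walk⇒conn (lift py ++ʷ walk-reverse xy ++ʷ lift xq)

  picks-⊆ : ∀ {A : Set} (F : List A) {f rest} → (f , rest) ∈ picks F → f ∈ F × (∀ {z} → z ∈ rest → z ∈ F)
  picks-⊆ (x ∷ F) (here refl) = here refl , there
  picks-⊆ (x ∷ F) (there p∈) with ∈-map⁻ _ p∈
  ... | (f′ , rest′) , p∈′ , refl with picks-⊆ F p∈′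
  ... | f∈ , rest⊆ = there f∈ , λ { (here refl) → here refl ; (there z∈) → there (rest⊆ z∈) }

  isBridge : Edge × List Edge → Bool
  isBridge ((x , y , _) , rest) = not (conn rest x y)

  isForest-∷ : ∀ F x y l → isForest ((x , y , l) ∷ F) ≡ (isForest F ∧ not (conn F x y))
  isForest-∷ F x y l with conn F x y in xy
  ... | true = sym (∧-zeroʳ (isForest F))
  ... | false =
    trans (allB-map isBridge (λ { (g , gs) → (g , (x , y , l) ∷ gs) }) (picks F))
      (trans (allB-cong _ isBridge (picks F) stillBridge) (sym (∧-identityʳ (isForest F))))
    where
    stillBridge : ∀ {p} → p ∈ picks F → isBridge (proj₁ p , (x , y , l) ∷ proj₂ p) ≡ isBridge p
    stillBridge {(a , b , _) , rest} p∈ with picks-⊆ F p∈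
    ... | ab∈F , rest⊆F = cong not (Bool-ext to (λ c → Walk⇒conn (walk-mono there (conn⇒Walk {rest} c))))
      where
      ab : Walk F a b
      ab = edge-walk ab∈F
      to : conn ((x , y , l) ∷ rest) a b ≡ true → conn rest a b ≡ true
      to c with walk-∷-split (conn⇒Walk {(x , y , l) ∷ rest} c)
      ... | inj₁ w = Walk⇒conn w
      ... | inj₂ (inj₁ (ax , yb)) = contradiction (trans (sym xy)
              (Walk⇒conn (walk-reverse (walk-mono rest⊆F ax) ++ʷ ab ++ʷ walk-reverse (walk-mono rest⊆F yb)))) false≢true
      ... | inj₂ (inj₂ (ay , xb)) = contradiction (trans (sym xy)
              (Walk⇒conn (walk-mono rest⊆F xb ++ʷ walk-reverse ab ++ʷ walk-mono rest⊆F ay))) false≢true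

module Components where

  open Booleans
  open Walks
  open Forests
  open import Data.Nat using (ℕ; zero; suc; _≡ᵇ_; _≤_; _<_; z≤n; s≤s; _+_)
  open import Data.Nat.Properties
    using (≤-refl; ≤-trans; <-cmp; <-irrefl; <-trans; ≤-<-trans; <-≤-trans; +-suc; +-comm; n≤1+n; <⇒≢; <⇒≤)
  open import Data.Bool using (Bool; true; false; _∧_; not)
  open import Data.List using (List; []; _∷_; _++_; length; upTo)
  open import Data.List.Properties using (upTo-∷ʳ; length-upTo)
  open import Data.List.Membership.Propositional using (_∈_)
  open import Data.List.Membership.Propositional.Properties using (∈-upTo⁻; ∈-upTo⁺)
  open import Data.List.Relation.Unary.Any using (here; there)
  open import Data.Product using (_×_; _,_; ∃; proj₁; proj₂)
  open import Data.Sum using (inj₁; inj₂)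
  open import Data.Empty using (⊥)
  open import Relation.Nullary using (contradiction)
  open import Relation.Binary.PropositionalEquality
  open import Relation.Binary.Definitions using (tri<; tri≈; tri>)

  isRoot : List Edge → ℕ → Bool
  isRoot F v = not (anyB (λ u → conn F u v) (upTo v))

  isRoot⇒noSmaller : ∀ {F v} → isRoot F v ≡ true → ∀ {u} → u < v → Walk F u v → ⊥
  isRoot⇒noSmaller {F} {v} r {u} u<v w with anyB (λ u → conn F u v) (upTo v) in eq
  ... | false = false≢true (trans (sym eq) (anyB-true⁺ (λ u → conn F u v) (upTo v) (∈-upTo⁺ u<v) (Walk⇒conn w)))

  notRoot⇒smaller : ∀ {F v} → isRoot F v ≡ false → ∃ λ u → u < v × Walk F u v
  notRoot⇒smaller {F} {v} r with anyB (λ u → conn F u v) (upTo v) in eq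
  ... | true with anyB-true⁻ (λ u → conn F u v) (upTo v) eq
  ... | u , u∈ , c = u , ∈-upTo⁻ u∈ , conn⇒Walk c

  noSmaller⇒isRoot : ∀ {F v} → (∀ {u} → u < v → Walk F u v → ⊥) → isRoot F v ≡ true
  noSmaller⇒isRoot {F} {v} h with isRoot F v in eq
  ... | true = refl
  ... | false with notRoot⇒smaller {F} eq
  ... | u , u<v , w = contradiction w (h u<v)

  root : ∀ F x → ∃ λ r → r ≤ x × isRoot F r ≡ true × Walk F r x
  root F x = search (suc x) x ≤-refl
    where
    search : ∀ n x → x < n → ∃ λ r → r ≤ x × isRoot F r ≡ true × Walk F r x
    search (suc n) x (s≤s x≤n) with isRoot F x in eq
    ... | true = x , ≤-refl , eq , nil
    ... | false with notRoot⇒smaller {F} eq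
    ... | u , u<x , ux with search n u (<-≤-trans u<x x≤n)
    ... | r , r≤u , rr , ru = r , ≤-trans r≤u (<⇒≤ u<x) , rr , ru ++ʷ ux

  connected-roots-≡ : ∀ {F r₁ r₂} → isRoot F r₁ ≡ true → isRoot F r₂ ≡ true → Walk F r₁ r₂ → r₁ ≡ r₂
  connected-roots-≡ {F} {r₁} {r₂} h₁ h₂ w with <-cmp r₁ r₂
  ... | tri< lt _ _ = contradiction w (isRoot⇒noSmaller h₂ lt)
  ... | tri≈ _ eq _ = eq
  ... | tri> _ _ gt = contradiction (walk-reverse w) (isRoot⇒noSmaller h₁ gt)

  countB-cong : ∀ {A : Set} (p q : A → Bool) xs → (∀ x → p x ≡ q x) → countB p xs ≡ countB q xs
  countB-cong p q [] h = refl
  countB-cong p q (x ∷ xs) h rewrite h x | countB-cong p q xs h = refl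

  countB-++ : ∀ {A : Set} (p : A → Bool) xs ys → countB p (xs ++ ys) ≡ countB p xs + countB p ys
  countB-++ p [] ys = refl
  countB-++ p (x ∷ xs) ys with p x
  ... | true = cong suc (countB-++ p xs ys)
  ... | false = countB-++ p xs ys

  countB-true : ∀ {A : Set} (xs : List A) → countB (λ _ → true) xs ≡ length xs
  countB-true [] = refl
  countB-true (x ∷ xs) = cong suc (countB-true xs)

  countB-split : ∀ (p : ℕ → Bool) r xs →
    countB p xs ≡ countB (λ v → p v ∧ not (v ≡ᵇ r)) xs + countB (λ v → p v ∧ (v ≡ᵇ r)) xs
  countB-split p r [] = refl
  countB-split p r (x ∷ xs) with p x | x ≡ᵇ r
  ... | true | true = trans (cong suc (countB-split p r xs)) (sym (+-suc _ _))
  ... | true | false = cong suc (countB-split p r xs)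
  ... | false | _ = countB-split p r xs

  countB-upTo-suc : ∀ (p : ℕ → Bool) n → countB p (upTo (suc n)) ≡ countB p (upTo n) + countB p (n ∷ [])
  countB-upTo-suc p n = trans (cong (countB p) (sym (upTo-∷ʳ n))) (countB-++ p (upTo n) (n ∷ []))

  count-≡ᵇ-upTo-≤ : ∀ n r → n ≤ r → countB (_≡ᵇ r) (upTo n) ≡ 0
  count-≡ᵇ-upTo-≤ zero r _ = refl
  count-≡ᵇ-upTo-≤ (suc n) r n<r
    rewrite countB-upTo-suc (_≡ᵇ r) n | count-≡ᵇ-upTo-≤ n r (≤-trans (n≤1+n n) n<r)
          | ≡ᵇ-false⁺ {n} {r} (λ n≡r → <-irrefl n≡r n<r) = refl

  count-≡ᵇ-upTo-> : ∀ n r → r < n → countB (_≡ᵇ r) (upTo n) ≡ 1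
  count-≡ᵇ-upTo-> (suc n) r (s≤s r≤n) rewrite countB-upTo-suc (_≡ᵇ r) n with <-cmp r n
  ... | tri< r<n _ _ rewrite count-≡ᵇ-upTo-> n r r<n | ≡ᵇ-false⁺ {n} {r} (λ n≡r → <-irrefl (sym n≡r) r<n) = refl
  ... | tri≈ _ refl _ rewrite count-≡ᵇ-upTo-≤ r r ≤-refl | ≡ᵇ-refl r = refl
  ... | tri> _ _ r>n = contradiction (<-≤-trans r>n r≤n) (<-irrefl refl)

  countB-upTo-remove : ∀ (p : ℕ → Bool) n r → r < n → p r ≡ true →
    countB p (upTo n) ≡ suc (countB (λ v → p v ∧ not (v ≡ᵇ r)) (upTo n))
  countB-upTo-remove p n r r<n pr =
    trans (countB-split p r (upTo n))
      (trans (cong (countB (λ v → p v ∧ not (v ≡ᵇ r)) (upTo n) +_)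
               (trans (countB-cong _ (_≡ᵇ r) (upTo n) only-r) (count-≡ᵇ-upTo-> n r r<n)))
             (+-comm _ 1))
    where
    only-r : ∀ v → (p v ∧ (v ≡ᵇ r)) ≡ (v ≡ᵇ r)
    only-r v with v ≡ᵇ r in eq
    ... | true rewrite ≡ᵇ-true⁻ {v} eq | pr = refl
    ... | false with p v
    ... | true = refl
    ... | false = refl

  components-[] : ∀ nv → components nv [] ≡ nv
  components-[] nv = trans (countB-cong (isRoot []) (λ _ → true) (upTo nv) allRoots)
                           (trans (countB-true (upTo nv)) (length-upTo nv))
    where
    walk-[]-trivial : ∀ {a b} → Walk [] a b → a ≡ b
    walk-[]-trivial nil = refl
    walk-[]-trivial (snoc _ (fwd ()))
    walk-[]-trivial (snoc _ (bwd ()))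
    allRoots : ∀ v → isRoot [] v ≡ true
    allRoots v = noSmaller⇒isRoot {[]} {v} (λ u<v w → <⇒≢ u<v (walk-[]-trivial w))

  -- Adding a bridge x—y merges the components with roots rx < ry: ry stops being a root.
  module AddBridge (F G : List Edge) (x y : ℕ)
    (split : ∀ {u v} → Walk G u v → WalkAround F x y u v)
    (lift : ∀ {u v} → Walk F u v → Walk G u v)
    (xy : Walk G x y)
    {rx ry : ℕ} (rx-root : isRoot F rx ≡ true) (ry-root : isRoot F ry ≡ true)
    (rx-x : Walk F rx x) (ry-y : Walk F ry y) (rx<ry : rx < ry) where

    isRoot-after : ∀ v → isRoot G v ≡ (isRoot F v ∧ not (v ≡ᵇ ry))
    isRoot-after v = Bool-ext to from
      where
      to : isRoot G v ≡ true → (isRoot F v ∧ not (v ≡ᵇ ry)) ≡ true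
      to h with isRoot F v in eq
      ... | false with notRoot⇒smaller {F} eq
      ... | u , u<v , w = contradiction (lift w) (isRoot⇒noSmaller {G} {v} h u<v)
      to h | true with v ≡ᵇ ry in eq₂
      ... | false = refl
      ... | true with ≡ᵇ-true⁻ {v} eq₂
      ... | refl = contradiction (lift rx-x ++ʷ xy ++ʷ lift (walk-reverse ry-y)) (isRoot⇒noSmaller {G} {v} h rx<ry)
      from : (isRoot F v ∧ not (v ≡ᵇ ry)) ≡ true → isRoot G v ≡ true
      from h with ∧-true⁻ {isRoot F v} h
      ... | v-root , v≢ry = noSmaller⇒isRoot smaller-impossible
        where
        smaller-impossible : ∀ {u} → u < v → Walk G u v → ⊥
        smaller-impossible u<v w with split w
        ... | inj₁ w′ = isRoot⇒noSmaller v-root u<v w′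
        ... | inj₂ (inj₁ (_ , yv)) with connected-roots-≡ ry-root v-root (ry-y ++ʷ yv)
        ... | refl = false≢true (trans (sym (cong not (≡ᵇ-refl ry))) v≢ry)
        smaller-impossible u<v w | inj₂ (inj₂ (uy , xv)) with connected-roots-≡ rx-root v-root (rx-x ++ʷ xv)
        ... | refl = isRoot⇒noSmaller ry-root (<-trans u<v rx<ry) (uy ++ʷ walk-reverse ry-y)

  components-∷-bridge : ∀ nv F x y l → x < nv → y < nv → conn F x y ≡ false →
    suc (components nv ((x , y , l) ∷ F)) ≡ components nv F
  components-∷-bridge nv F x y l x<nv y<nv x≁y with root F x | root F y
  ... | rx , rx≤x , rx-root , rx-x | ry , ry≤y , ry-root , ry-y with <-cmp rx ry
  ... | tri≈ _ refl _ = contradiction (Walk⇒conn (walk-reverse rx-x ++ʷ ry-y)) (λ c → false≢true (trans (sym x≁y) c))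
  ... | tri< rx<ry _ _ =
    let open AddBridge F G x y walk-∷-split (walk-mono there) (edge-walk (here refl)) rx-root ry-root rx-x ry-y rx<ry
    in trans (cong suc (countB-cong (isRoot G) _ (upTo nv) isRoot-after))
             (sym (countB-upTo-remove (isRoot F) nv ry (≤-<-trans ry≤y y<nv) ry-root))
    where G = (x , y , l) ∷ F
  ... | tri> _ _ ry<rx =
    let open AddBridge F G y x (λ w → WalkAround-swap (walk-∷-split w)) (walk-mono there)
                       (walk-reverse (edge-walk (here refl))) ry-root rx-root ry-y rx-x ry<rx
    in trans (cong suc (countB-cong (isRoot G) _ (upTo nv) isRoot-after))
             (sym (countB-upTo-remove (isRoot F) nv rx (≤-<-trans rx≤x x<nv) rx-root))
    where G = (x , y , l) ∷ F

  EdgesBelow : ℕ → List Edge → Set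
  EdgesBelow nv F = ∀ {x y l} → (x , y , l) ∈ F → x < nv × y < nv

  forest-components+edges : ∀ nv F → EdgesBelow nv F → isForest F ≡ true → components nv F + length F ≡ nv
  forest-components+edges nv [] _ _ = trans (+-comm (components nv []) 0) (components-[] nv)
  forest-components+edges nv ((x , y , l) ∷ F) below forest
    with ∧-true⁻ {isForest F} (trans (sym (isForest-∷ F x y l)) forest)
  ... | F-forest , x≁y =
    trans (+-suc (components nv ((x , y , l) ∷ F)) (length F))
      (trans (cong (_+ length F)
               (components-∷-bridge nv F x y l (proj₁ (below (here refl))) (proj₂ (below (here refl))) (not-true⁻ x≁y)))
             (forest-components+edges nv F (λ e → below (there e)) F-forest))

  roots-distinct : ∀ F {p q r₁ r₂} → conn F p q ≡ false → Walk F r₁ p → Walk F r₂ q → (r₂ ≡ᵇ r₁) ≡ false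
  roots-distinct F {r₁ = r₁} {r₂} p≁q r₁p r₂q =
    ≡ᵇ-false⁺ {r₂} {r₁} (λ { refl → false≢true (trans (sym p≁q) (Walk⇒conn (walk-reverse r₁p ++ʷ r₂q))) })

  components≥1 : ∀ nv F a → a < nv → 1 ≤ components nv F
  components≥1 nv F a a<nv with root F a
  ... | ra , ra≤a , ra-root , _ rewrite countB-upTo-remove (isRoot F) nv ra (≤-<-trans ra≤a a<nv) ra-root = s≤s z≤n

  components≥2 : ∀ nv F a b → a < nv → b < nv → conn F a b ≡ false → 2 ≤ components nv F
  components≥2 nv F a b a<nv b<nv a≁b with root F a | root F b
  ... | ra , ra≤a , ra-root , ra-a | rb , rb≤b , rb-root , rb-b
    rewrite countB-upTo-remove (isRoot F) nv ra (≤-<-trans ra≤a a<nv) ra-root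
          | countB-upTo-remove (λ v → isRoot F v ∧ not (v ≡ᵇ ra)) nv rb (≤-<-trans rb≤b b<nv)
              (∧-not-true⁺ rb-root (roots-distinct F a≁b ra-a rb-b)) = s≤s (s≤s z≤n)

  components≥3 : ∀ nv F a b c → a < nv → b < nv → c < nv →
    conn F a b ≡ false → conn F a c ≡ false → conn F b c ≡ false → 3 ≤ components nv F
  components≥3 nv F a b c a<nv b<nv c<nv a≁b a≁c b≁c with root F a | root F b | root F c
  ... | ra , ra≤a , ra-root , ra-a | rb , rb≤b , rb-root , rb-b | rc , rc≤c , rc-root , rc-c
    rewrite countB-upTo-remove (isRoot F) nv ra (≤-<-trans ra≤a a<nv) ra-root
          | countB-upTo-remove (λ v → isRoot F v ∧ not (v ≡ᵇ ra)) nv rb (≤-<-trans rb≤b b<nv)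
              (∧-not-true⁺ rb-root (roots-distinct F a≁b ra-a rb-b))
          | countB-upTo-remove (λ v → (isRoot F v ∧ not (v ≡ᵇ ra)) ∧ not (v ≡ᵇ rb)) nv rc (≤-<-trans rc≤c c<nv)
              (∧-not-true⁺ (∧-not-true⁺ rc-root (roots-distinct F a≁c ra-a rc-c)) (roots-distinct F b≁c rb-b rc-c))
          = s≤s (s≤s (s≤s z≤n))

module Gluing where

  open import Data.List.Relation.Binary.Subset.Propositional using (_⊆_)
  open Components using (EdgesBelow)
  open import Data.Nat using (ℕ; zero; suc; _≤_; _<_; z≤n; s≤s; _+_; _*_; _∸_)
  open import Data.Nat.Properties
    using (≤-refl; +-assoc; +-comm; +-cancelˡ-≡; m+n≮m; m≤m+n; <-≤-trans; +-monoʳ-<; +-mono-≤-<; <ᵇ⇒<)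
  open import Data.Nat.Tactic.RingSolver using (solve-∀)
  open import Data.List using (List; _++_; map)
  open import Data.List.Membership.Propositional using (_∈_)
  open import Data.List.Membership.Propositional.Properties using (∈-map⁻; ∈-++⁺ˡ; ∈-++⁺ʳ; ∈-++⁻)
  open import Data.List.Relation.Unary.Any using (here; there)
  open import Data.Product using (_×_; _,_; Σ; ∃; proj₁; proj₂)
  open import Data.Sum using (_⊎_; inj₁; inj₂)
  open import Relation.Nullary using (contradiction)
  open import Relation.Binary.PropositionalEquality

  data Piece : Set where
    X Y Z : Piece

  Triple : Set → Set
  Triple A = A × A × A

  module _ {A : Set} where

    _!_ : Triple A → Piece → A
    (a , _ , _) ! X = a
    (_ , b , _) ! Y = b
    (_ , _ , c) ! Z = c

    update : Triple A → Piece → A → Triple A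
    update (a , b , c) X a′ = (a′ , b , c)
    update (a , b , c) Y b′ = (a , b′ , c)
    update (a , b , c) Z c′ = (a , b , c′)

    update-! : ∀ t P x → update t P x ! P ≡ x
    update-! _ X _ = refl
    update-! _ Y _ = refl
    update-! _ Z _ = refl

  mapTriple : ∀ {A B : Set} → (A → B) → Triple A → Triple B
  mapTriple f (a , b , c) = (f a , f b , f c)

  mapTriple-! : ∀ {A B : Set} (f : A → B) t P → mapTriple f t ! P ≡ f (t ! P)
  mapTriple-! f _ X = refl
  mapTriple-! f _ Y = refl
  mapTriple-! f _ Z = refl

  mapTriple-update : ∀ {A B : Set} (f : A → B) t P x → mapTriple f (update t P x) ≡ update (mapTriple f t) P (f x)
  mapTriple-update f _ X _ = refl
  mapTriple-update f _ Y _ = refl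
  mapTriple-update f _ Z _ = refl

  embed : Piece → ℕ → ℕ → ℕ
  embed X = embX
  embed Y = embY
  embed Z = embZ

  -- The corners of a copy land among the six vertices 0–5 independently of k.
  corner : Piece → ℕ → ℕ
  corner P = embed P 0

  offset : Piece → ℕ → ℕ
  offset X k = 0
  offset Y k = k
  offset Z k = k + k

  data CornerOrInner : ℕ → Set where
    isCorner : ∀ {i} → i < 3 → CornerOrInner i
    isInner : ∀ v → CornerOrInner (3 + v)

  cornerOrInner : ∀ a → CornerOrInner a
  cornerOrInner 0 = isCorner (s≤s z≤n)
  cornerOrInner 1 = isCorner (s≤s (s≤s z≤n))
  cornerOrInner 2 = isCorner (s≤s (s≤s (s≤s z≤n)))
  cornerOrInner (suc (suc (suc v))) = isInner v

  embed-inner : ∀ P k v → embed P k (3 + v) ≡ 6 + (offset P k + v)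
  embed-inner X k v = refl
  embed-inner Y k v = +-assoc 6 k v
  embed-inner Z k v = trans (+-assoc (6 + k) k v) (trans (+-assoc 6 k (k + v)) (cong (6 +_) (sym (+-assoc k k v))))

  embed-corner : ∀ P k {i} → i < 3 → embed P k i ≡ corner P i
  embed-corner X k {0} _ = refl
  embed-corner X k {1} _ = refl
  embed-corner X k {2} _ = refl
  embed-corner Y k {0} _ = refl
  embed-corner Y k {1} _ = refl
  embed-corner Y k {2} _ = refl
  embed-corner Z k {0} _ = refl
  embed-corner Z k {1} _ = refl
  embed-corner Z k {2} _ = refl
  embed-corner _ k {suc (suc (suc _))} (s≤s (s≤s (s≤s ())))

  corner<6 : ∀ P {i} → i < 3 → corner P i < 6
  corner<6 X {0} _ = <ᵇ⇒< 0 6 _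
  corner<6 X {1} _ = <ᵇ⇒< 4 6 _
  corner<6 X {2} _ = <ᵇ⇒< 3 6 _
  corner<6 Y {0} _ = <ᵇ⇒< 5 6 _
  corner<6 Y {1} _ = <ᵇ⇒< 1 6 _
  corner<6 Y {2} _ = <ᵇ⇒< 3 6 _
  corner<6 Z {0} _ = <ᵇ⇒< 5 6 _
  corner<6 Z {1} _ = <ᵇ⇒< 4 6 _
  corner<6 Z {2} _ = <ᵇ⇒< 2 6 _
  corner<6 _ {suc (suc (suc _))} (s≤s (s≤s (s≤s ())))

  corner≢inner : ∀ P Q k {i} v → i < 3 → embed P k i ≢ embed Q k (3 + v)
  corner≢inner P Q k v i<3 eq =
    m+n≮m 6 _ (subst (_< 6) (trans (sym (embed-corner P k i<3)) (trans eq (embed-inner Q k v))) (corner<6 P i<3))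

  offsets-disjoint : ∀ P Q k {a b} → a < k → b < k → offset P k + a ≡ offset Q k + b → P ≡ Q × a ≡ b
  offsets-disjoint X X k _ _ eq = refl , eq
  offsets-disjoint Y Y k _ _ eq = refl , +-cancelˡ-≡ k _ _ eq
  offsets-disjoint Z Z k _ _ eq = refl , +-cancelˡ-≡ (k + k) _ _ eq
  offsets-disjoint X Y k {a} {b} a<k _ eq = contradiction (subst (_< k) eq a<k) (m+n≮m k b)
  offsets-disjoint Y X k {a} _ b<k eq = contradiction (subst (_< k) (sym eq) b<k) (m+n≮m k a)
  offsets-disjoint X Z k {a} {b} a<k _ eq = contradiction (subst (_< k) (trans eq (+-assoc k k b)) a<k) (m+n≮m k _)
  offsets-disjoint Z X k {a} _ b<k eq = contradiction (subst (_< k) (trans (sym eq) (+-assoc k k a)) b<k) (m+n≮m k _)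
  offsets-disjoint Y Z k {a} {b} a<k _ eq =
    contradiction (subst (_< k) (+-cancelˡ-≡ k a (k + b) (trans eq (+-assoc k k b))) a<k) (m+n≮m k b)
  offsets-disjoint Z Y k {a} {b} _ b<k eq =
    contradiction (subst (_< k) (+-cancelˡ-≡ k b (k + a) (trans (sym eq) (+-assoc k k a))) b<k) (m+n≮m k a)

  embed-injective : ∀ P Q k {a b} → a < 3 + k → b < 3 + k → embed P k a ≡ embed Q k b →
                    (P ≡ Q × a ≡ b) ⊎ (a < 3 × b < 3)
  embed-injective P Q k {a} {b} a< b< eq with cornerOrInner a | cornerOrInner b
  ... | isCorner a<3 | isCorner b<3 = inj₂ (a<3 , b<3)
  ... | isCorner a<3 | isInner v = contradiction eq (corner≢inner P Q k v a<3)
  ... | isInner v | isCorner b<3 = contradiction (sym eq) (corner≢inner Q P k v b<3)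
  embed-injective P Q k (s≤s (s≤s (s≤s a<k))) (s≤s (s≤s (s≤s b<k))) eq | isInner u | isInner v
    with offsets-disjoint P Q k a<k b<k (+-cancelˡ-≡ 6 _ _ (trans (sym (embed-inner P k u)) (trans eq (embed-inner Q k v))))
  ... | refl , refl = inj₁ (refl , refl)

  Pieces : Set
  Pieces = Triple (List Edge)

  glue : ℕ → Pieces → List Edge
  glue k (a , b , c) = map (mapEdge (embX k)) a ++ map (mapEdge (embY k)) b ++ map (mapEdge (embZ k)) c

  piece⊆glue : ∀ k g P → map (mapEdge (embed P k)) (g ! P) ⊆ glue k g
  piece⊆glue k (a , b , c) X e = ∈-++⁺ˡ e
  piece⊆glue k (a , b , c) Y e = ∈-++⁺ʳ (map (mapEdge (embX k)) a) (∈-++⁺ˡ e)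
  piece⊆glue k (a , b , c) Z e = ∈-++⁺ʳ (map (mapEdge (embX k)) a) (∈-++⁺ʳ (map (mapEdge (embY k)) b) e)

  ∈-glue⁻ : ∀ k g {e} → e ∈ glue k g → ∃ λ P → ∃ λ e₀ → e₀ ∈ g ! P × e ≡ mapEdge (embed P k) e₀
  ∈-glue⁻ k (a , b , c) e∈ with ∈-++⁻ (map (mapEdge (embX k)) a) e∈
  ... | inj₁ e∈X = let e₀ , e₀∈ , eq = ∈-map⁻ _ e∈X in X , e₀ , e₀∈ , eq
  ... | inj₂ e∈YZ with ∈-++⁻ (map (mapEdge (embY k)) b) e∈YZ
  ... | inj₁ e∈Y = let e₀ , e₀∈ , eq = ∈-map⁻ _ e∈Y in Y , e₀ , e₀∈ , eq
  ... | inj₂ e∈Z = let e₀ , e₀∈ , eq = ∈-map⁻ _ e∈Z in Z , e₀ , e₀∈ , eq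

  PiecesBelow : ℕ → Pieces → Set
  PiecesBelow nv g = ∀ P → EdgesBelow nv (g ! P)

  gluedSize : ℕ → ℕ
  gluedSize k = 3 * (3 + k) ∸ 3

  gluedSize≡ : ∀ k → gluedSize k ≡ 6 + (k + (k + k))
  gluedSize≡ k = normalised k
    where
    normalised : ∀ k → k + ((3 + k) + ((3 + k) + 0)) ≡ 6 + (k + (k + k))
    normalised = solve-∀

  offset≤ : ∀ P k → offset P k ≤ k + k
  offset≤ X k = z≤n
  offset≤ Y k = m≤m+n k k
  offset≤ Z k = ≤-refl

  embed<gluedSize : ∀ P k {v} → v < 3 + k → embed P k v < gluedSize k
  embed<gluedSize P k {v} v< rewrite gluedSize≡ k with cornerOrInner v
  ... | isCorner v<3 = subst (_< 6 + _) (sym (embed-corner P k v<3)) (<-≤-trans (corner<6 P v<3) (m≤m+n 6 _))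
  embed<gluedSize P k (s≤s (s≤s (s≤s u<k))) | isInner u rewrite embed-inner P k u =
    +-monoʳ-< 6 (subst (offset P k + u <_) (+-comm (k + k) k) (+-mono-≤-< (offset≤ P k) u<k))

  glue-below : ∀ k g → PiecesBelow (3 + k) g → EdgesBelow (gluedSize k) (glue k g)
  glue-below k g below e∈ with ∈-glue⁻ k g e∈
  ... | P , (x , y , l) , e₀∈ , refl = embed<gluedSize P k (proj₁ (below P e₀∈)) , embed<gluedSize P k (proj₂ (below P e₀∈))

  Γ-shape : ∀ n → Σ ℕ λ k → nv (Γ (suc n)) ≡ 3 + k × EdgesBelow (3 + k) (edges (Γ (suc n)))
  Γ-shape zero = 0 , refl , Γ₁-below
    where
    Γ₁-below : EdgesBelow 3 (edges Γ₁)
    Γ₁-below (here refl) = s≤s z≤n , s≤s (s≤s z≤n)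
    Γ₁-below (there (here refl)) = s≤s (s≤s z≤n) , s≤s (s≤s (s≤s z≤n))
    Γ₁-below (there (there (here refl))) = s≤s (s≤s (s≤s z≤n)) , s≤s z≤n
  Γ-shape (suc n) with Γ-shape n
  ... | k , size , below = 3 + (k + (k + k)) , trans (cong (λ m → 3 * m ∸ 3) size) (gluedSize≡ k) , below′
    where
    E = edges (Γ (suc n))
    below′ : EdgesBelow (3 + (3 + (k + (k + k)))) (edges (Γ (suc (suc n))))
    below′ rewrite size = subst (λ m → EdgesBelow m (glue k (E , E , E))) (gluedSize≡ k)
                            (glue-below k (E , E , E) λ { X → below ; Y → below ; Z → below })

module CornerAbstraction where

  open Booleans
  open Gluing
  open import Data.Nat using (ℕ; _≡ᵇ_; _+_)
  open import Data.Bool using (Bool; true; false; _∧_; _∨_; not; if_then_else_)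
  open import Data.List using (List; []; _∷_; cartesianProduct)
  open import Data.List.Membership.Propositional using (_∈_)
  open import Data.List.Membership.Propositional.Properties using (∈-cartesianProduct⁺)
  open import Data.List.Relation.Unary.Any using (here; there)
  open import Data.Product using (_×_; _,_)
  open import Relation.Binary.PropositionalEquality

  -- A triple of booleans indexed by the corners 0 (top), 1 (left), 2 (right) of a copy of Γ n:
  -- the corners a vertex reaches, or (for CornerLinks) whether the pairs 0–1, 0–2, 1–2 are connected.
  Corners : Set
  Corners = Bool × Bool × Bool

  CornerLinks : Set
  CornerLinks = Bool × Bool × Bool

  _∋ᶜ_ : Corners → ℕ → Bool
  (a , b , c) ∋ᶜ 0 = a
  (a , b , c) ∋ᶜ 1 = b
  (a , b , c) ∋ᶜ 2 = c
  _ ∋ᶜ _ = false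

  linked : CornerLinks → ℕ → ℕ → Bool
  linked t 0 0 = true
  linked t 1 1 = true
  linked t 2 2 = true
  linked (l₀₁ , l₀₂ , l₁₂) 0 1 = l₀₁
  linked (l₀₁ , l₀₂ , l₁₂) 1 0 = l₀₁
  linked (l₀₁ , l₀₂ , l₁₂) 0 2 = l₀₂
  linked (l₀₁ , l₀₂ , l₁₂) 2 0 = l₀₂
  linked (l₀₁ , l₀₂ , l₁₂) 1 2 = l₁₂
  linked (l₀₁ , l₀₂ , l₁₂) 2 1 = l₁₂
  linked _ _ _ = false

  corners : List ℕ
  corners = 0 ∷ 1 ∷ 2 ∷ []

  -- The transitive CornerLinks, i.e. the five partitions of the three corners.
  partitions : List CornerLinks
  partitions = (true , true , true) ∷ (true , false , false) ∷ (false , true , false)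
             ∷ (false , false , true) ∷ (false , false , false) ∷ []

  -- (meaningful for the five partitions only)
  blocks : CornerLinks → ℕ
  blocks (l₀₁ , l₀₂ , l₁₂) = 1 + (if l₀₁ then 0 else 1) + (if l₀₂ ∨ l₁₂ then 0 else 1)

  Profile : Set
  Profile = Triple CornerLinks

  -- Union–find on the six gluing vertices 0–5 of Γ (n+1): merging along the links of
  -- every copy labels each vertex by a representative of its class.
  Labelling : Set
  Labelling = ℕ → ℕ

  merge : Labelling → ℕ → ℕ → Labelling
  merge f a b u = if f u ≡ᵇ f b then f a else f u

  mergeIf : Bool → ℕ → ℕ → Labelling → Labelling
  mergeIf true a b f = merge f a b
  mergeIf false a b f = f

  mergeLinks : Piece → CornerLinks → Labelling → Labelling
  mergeLinks P (l₀₁ , l₀₂ , l₁₂) f =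
    mergeIf l₁₂ (corner P 1) (corner P 2) (mergeIf l₀₂ (corner P 0) (corner P 2) (mergeIf l₀₁ (corner P 0) (corner P 1) f))

  gluedLabel : Profile → Labelling
  gluedLabel (a , b , c) = mergeLinks Z c (mergeLinks Y b (mergeLinks X a (λ u → u)))

  labelClasses : Labelling → ℕ
  labelClasses f = countB (λ u → f u ≡ᵇ u) (0 ∷ 1 ∷ 2 ∷ 3 ∷ 4 ∷ 5 ∷ [])

  totalBlocks : Profile → ℕ
  totalBlocks (a , b , c) = blocks a + blocks b + blocks c

  -- A copy whose corners fall into `blocks t` classes contributes 3 − blocks t tree edges
  -- between the six gluing vertices; these edges form a forest iff 6 − Σ (3 − blocks) is the
  -- number of resulting classes.
  opaque
    acyclicGluing : Profile → Bool
    acyclicGluing σ = totalBlocks σ ≡ᵇ (labelClasses (gluedLabel σ) + 3)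

  linksAfterEdge : CornerLinks → Corners → Corners → CornerLinks
  linksAfterEdge t S T = (new 0 1 , new 0 2 , new 1 2)
    where
    new : ℕ → ℕ → Bool
    new i j = linked t i j ∨ (S ∋ᶜ i ∧ T ∋ᶜ j) ∨ (T ∋ᶜ i ∧ S ∋ᶜ j)

  joinedOutside : Profile → Piece → Corners → Corners → Bool
  joinedOutside σ P S T =
    anyB (λ p → anyB (λ q → S ∋ᶜ p ∧ T ∋ᶜ q ∧ (gluedLabel σ (corner P p) ≡ᵇ gluedLabel σ (corner P q))) corners) corners

  -- Corner sets reached from two unconnected vertices of a graph whose corners are linked by t:
  -- each is closed under t and lies inside one block, and they are disjoint.
  reachSetsConsistent : CornerLinks → Corners → Corners → Bool
  reachSetsConsistent t S T = allB (λ i → allB (λ j →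
       ((S ∋ᶜ i ∧ linked t i j) ⇒ᵇ S ∋ᶜ j) ∧ ((T ∋ᶜ i ∧ linked t i j) ⇒ᵇ T ∋ᶜ j)
       ∧ ((S ∋ᶜ i ∧ S ∋ᶜ j) ⇒ᵇ linked t i j) ∧ ((T ∋ᶜ i ∧ T ∋ᶜ j) ⇒ᵇ linked t i j)) corners
       ∧ not (S ∋ᶜ i ∧ T ∋ᶜ i)) corners

  allCorners : List Corners
  allCorners = (true , true , true) ∷ (true , true , false) ∷ (true , false , true) ∷ (true , false , false)
             ∷ (false , true , true) ∷ (false , true , false) ∷ (false , false , true) ∷ (false , false , false) ∷ []

  pieces : List Piece
  pieces = X ∷ Y ∷ Z ∷ []

  addEdgeSound : Piece → Profile → Corners → Corners → Bool
  addEdgeSound P σ S T = reachSetsConsistent (σ ! P) S T ⇒ᵇ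
    (acyclicGluing (update σ P (linksAfterEdge (σ ! P) S T)) == (acyclicGluing σ ∧ not (joinedOutside σ P S T)))

  addEdgeSoundCase : Piece × Profile × Corners × Corners → Bool
  addEdgeSoundCase (P , σ , S , T) = addEdgeSound P σ S T

  addEdgeCases : List (Piece × Profile × Corners × Corners)
  addEdgeCases = cartesianProduct pieces
    (cartesianProduct (cartesianProduct partitions (cartesianProduct partitions partitions))
      (cartesianProduct allCorners allCorners))

  addEdgeSoundEverywhere : Bool
  addEdgeSoundEverywhere = allB addEdgeSoundCase addEdgeCases

  opaque
    unfolding acyclicGluing

    addEdgeSoundEverywhere-holds : addEdgeSoundEverywhere ≡ true
    addEdgeSoundEverywhere-holds = refl

    acyclicGluing-empty : acyclicGluing ((false , false , false) , (false , false , false) , (false , false , false)) ≡ true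
    acyclicGluing-empty = refl

  ∈-allCorners : ∀ S → S ∈ allCorners
  ∈-allCorners (true , true , true) = here refl
  ∈-allCorners (true , true , false) = there (here refl)
  ∈-allCorners (true , false , true) = there (there (here refl))
  ∈-allCorners (true , false , false) = there (there (there (here refl)))
  ∈-allCorners (false , true , true) = there (there (there (there (here refl))))
  ∈-allCorners (false , true , false) = there (there (there (there (there (here refl)))))
  ∈-allCorners (false , false , true) = there (there (there (there (there (there (here refl))))))
  ∈-allCorners (false , false , false) = there (there (there (there (there (there (there (here refl)))))))

  ∈-pieces : ∀ P → P ∈ pieces
  ∈-pieces X = here refl
  ∈-pieces Y = there (here refl)
  ∈-pieces Z = there (there (here refl))

  addEdgeSound-at : ∀ P {a b c} S T → a ∈ partitions → b ∈ partitions → c ∈ partitions →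
    reachSetsConsistent ((a , b , c) ! P) S T ≡ true →
    acyclicGluing (update (a , b , c) P (linksAfterEdge ((a , b , c) ! P) S T))
      ≡ (acyclicGluing (a , b , c) ∧ not (joinedOutside (a , b , c) P S T))
  addEdgeSound-at P {a} {b} {c} S T a∈ b∈ c∈ consistent =
    ==-true⁻ (⇒ᵇ-true⁻ (allB-true⁻ addEdgeSoundCase addEdgeCases addEdgeSoundEverywhere-holds case∈) consistent)
    where
    case∈ : (P , (a , b , c) , S , T) ∈ addEdgeCases
    case∈ = ∈-cartesianProduct⁺ (∈-pieces P)
              (∈-cartesianProduct⁺ (∈-cartesianProduct⁺ a∈ (∈-cartesianProduct⁺ b∈ c∈))
                (∈-cartesianProduct⁺ (∈-allCorners S) (∈-allCorners T)))

module GluedConnectivity where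

  open Booleans
  open Walks
  open Forests using (conn-∷)
  open Gluing
  open CornerAbstraction
  open import Data.Nat using (ℕ; suc; _≡ᵇ_; _<_; z≤n; s≤s; _+_)
  open import Data.Nat.Properties using (<-≤-trans; m≤m+n)
  open import Data.Bool using (Bool; true; false; _∧_; not)
  open import Data.List using (List; _∷_)
  open import Data.List.Membership.Propositional using (_∈_)
  open import Data.List.Relation.Unary.Any using (here; there)
  open import Data.Product using (_×_; _,_; Σ; ∃; proj₁; proj₂)
  open import Data.Sum using (_⊎_; inj₁; inj₂)
  open import Relation.Nullary using (contradiction)
  open import Relation.Binary.PropositionalEquality

  cornerLinks : List Edge → CornerLinks
  cornerLinks G = (conn G 0 1 , conn G 0 2 , conn G 1 2)

  reachedCorners : List Edge → ℕ → Corners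
  reachedCorners G x = (conn G x 0 , conn G x 1 , conn G x 2)

  <3⇒∈corners : ∀ {p} → p < 3 → p ∈ corners
  <3⇒∈corners {0} _ = here refl
  <3⇒∈corners {1} _ = there (here refl)
  <3⇒∈corners {2} _ = there (there (here refl))
  <3⇒∈corners {suc (suc (suc _))} (s≤s (s≤s (s≤s ())))

  ∈corners⇒<3 : ∀ {p} → p ∈ corners → p < 3
  ∈corners⇒<3 (here refl) = s≤s z≤n
  ∈corners⇒<3 (there (here refl)) = s≤s (s≤s z≤n)
  ∈corners⇒<3 (there (there (here refl))) = s≤s (s≤s (s≤s z≤n))

  reachedCorners-∋ : ∀ G x {p} → p < 3 → reachedCorners G x ∋ᶜ p ≡ conn G x p
  reachedCorners-∋ G x {0} _ = refl
  reachedCorners-∋ G x {1} _ = refl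
  reachedCorners-∋ G x {2} _ = refl
  reachedCorners-∋ G x {suc (suc (suc _))} (s≤s (s≤s (s≤s ())))

  linked-cornerLinks : ∀ G {i j} → i < 3 → j < 3 → linked (cornerLinks G) i j ≡ conn G i j
  linked-cornerLinks G {0} {0} _ _ = sym (Walk⇒conn {G} nil)
  linked-cornerLinks G {1} {1} _ _ = sym (Walk⇒conn {G} nil)
  linked-cornerLinks G {2} {2} _ _ = sym (Walk⇒conn {G} nil)
  linked-cornerLinks G {0} {1} _ _ = refl
  linked-cornerLinks G {0} {2} _ _ = refl
  linked-cornerLinks G {1} {2} _ _ = refl
  linked-cornerLinks G {1} {0} _ _ = conn-sym G 0 1
  linked-cornerLinks G {2} {0} _ _ = conn-sym G 0 2
  linked-cornerLinks G {2} {1} _ _ = conn-sym G 1 2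
  linked-cornerLinks G {suc (suc (suc _))} (s≤s (s≤s (s≤s ()))) _
  linked-cornerLinks G {_} {suc (suc (suc _))} _ (s≤s (s≤s (s≤s ())))

  cornerLinks∈partitions : ∀ G → cornerLinks G ∈ partitions
  cornerLinks∈partitions G with conn G 0 1 in c₀₁ | conn G 0 2 in c₀₂ | conn G 1 2 in c₁₂
  ... | true | true | true = here refl
  ... | true | false | false = there (here refl)
  ... | false | true | false = there (there (here refl))
  ... | false | false | true = there (there (there (here refl)))
  ... | false | false | false = there (there (there (there (here refl))))
  ... | true | true | false = contradiction (Walk⇒conn (walk-reverse (conn⇒Walk {G} c₀₁) ++ʷ conn⇒Walk c₀₂)) (λ c → false≢true (trans (sym c₁₂) c))
  ... | true | false | true = contradiction (Walk⇒conn (conn⇒Walk {G} c₀₁ ++ʷ conn⇒Walk c₁₂)) (λ c → false≢true (trans (sym c₀₂) c))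
  ... | false | true | true = contradiction (Walk⇒conn (conn⇒Walk {G} c₀₂ ++ʷ walk-reverse (conn⇒Walk c₁₂))) (λ c → false≢true (trans (sym c₀₁) c))

  reachSetsConsistent-holds : ∀ G x y → conn G x y ≡ false →
    reachSetsConsistent (cornerLinks G) (reachedCorners G x) (reachedCorners G y) ≡ true
  reachSetsConsistent-holds G x y x≁y =
    allB-true⁺ _ corners λ i∈ → ∧-true⁺ (allB-true⁺ _ corners λ j∈ → closed (∈corners⇒<3 i∈) (∈corners⇒<3 j∈))
                                        (disjoint (∈corners⇒<3 i∈))
    where
    transport : ∀ {z a b} → conn G z a ∧ conn G a b ≡ true → conn G z b ≡ true
    transport {z} h = let za , ab = ∧-true⁻ {conn G z _} h in Walk⇒conn (conn⇒Walk {G} za ++ʷ conn⇒Walk ab)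
    together : ∀ {z a b} → conn G z a ∧ conn G z b ≡ true → conn G a b ≡ true
    together {z} h = let za , zb = ∧-true⁻ {conn G z _} h in Walk⇒conn (walk-reverse (conn⇒Walk {G} za) ++ʷ conn⇒Walk zb)
    Sx = reachedCorners G x
    Sy = reachedCorners G y
    t = cornerLinks G
    closed : ∀ {i j} → i < 3 → j < 3 →
      (((Sx ∋ᶜ i ∧ linked t i j) ⇒ᵇ Sx ∋ᶜ j) ∧ ((Sy ∋ᶜ i ∧ linked t i j) ⇒ᵇ Sy ∋ᶜ j)
       ∧ ((Sx ∋ᶜ i ∧ Sx ∋ᶜ j) ⇒ᵇ linked t i j) ∧ ((Sy ∋ᶜ i ∧ Sy ∋ᶜ j) ⇒ᵇ linked t i j)) ≡ true
    closed i<3 j<3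
      rewrite linked-cornerLinks G i<3 j<3 | reachedCorners-∋ G x i<3 | reachedCorners-∋ G x j<3
            | reachedCorners-∋ G y i<3 | reachedCorners-∋ G y j<3 =
      ∧-true⁺ (⇒ᵇ-true⁺ transport) (∧-true⁺ (⇒ᵇ-true⁺ transport) (∧-true⁺ (⇒ᵇ-true⁺ together) (⇒ᵇ-true⁺ together)))
    disjoint : ∀ {i} → i < 3 → not (Sx ∋ᶜ i ∧ Sy ∋ᶜ i) ≡ true
    disjoint {i} i<3 rewrite reachedCorners-∋ G x i<3 | reachedCorners-∋ G y i<3 with conn G x i in xi | conn G y i in yi
    ... | true | true = contradiction (Walk⇒conn (conn⇒Walk {G} xi ++ʷ walk-reverse (conn⇒Walk yi))) (λ c → false≢true (trans (sym x≁y) c))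
    ... | true | false = refl
    ... | false | _ = refl

  cornerLinks-∷ : ∀ G x y l → cornerLinks ((x , y , l) ∷ G) ≡ linksAfterEdge (cornerLinks G) (reachedCorners G x) (reachedCorners G y)
  cornerLinks-∷ G x y l rewrite conn-∷ G x y l 0 1 | conn-∷ G x y l 0 2 | conn-∷ G x y l 1 2
    | conn-sym G 0 x | conn-sym G 0 y | conn-sym G 1 x | conn-sym G 1 y = refl

  Refines : Labelling → Labelling → Set
  Refines f f′ = ∀ {u v} → f u ≡ f v → f′ u ≡ f′ v

  merge-refines : ∀ f a b → Refines f (merge f a b)
  merge-refines f a b eq rewrite eq = refl

  mergeIf-refines : ∀ c a b f → Refines f (mergeIf c a b f)
  mergeIf-refines true a b f = merge-refines f a b
  mergeIf-refines false a b f eq = eq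

  mergeLinks-refines : ∀ P t f → Refines f (mergeLinks P t f)
  mergeLinks-refines P (l₀₁ , l₀₂ , l₁₂) f eq =
    mergeIf-refines l₁₂ _ _ _ (mergeIf-refines l₀₂ _ _ _ (mergeIf-refines l₀₁ _ _ _ eq))

  merge-joins : ∀ f a b → merge f a b a ≡ merge f a b b
  merge-joins f a b rewrite ≡ᵇ-refl (f b) with f a ≡ᵇ f b
  ... | true = refl
  ... | false = refl

  mergeLinks-joins : ∀ P t f {i j} → linked t i j ≡ true → mergeLinks P t f (corner P i) ≡ mergeLinks P t f (corner P j)
  mergeLinks-joins P t f {0} {0} _ = refl
  mergeLinks-joins P t f {1} {1} _ = refl
  mergeLinks-joins P t f {2} {2} _ = refl
  mergeLinks-joins P (true , l₀₂ , l₁₂) f {0} {1} refl =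
    mergeIf-refines l₁₂ _ _ _ (mergeIf-refines l₀₂ _ _ _ (merge-joins f (corner P 0) (corner P 1)))
  mergeLinks-joins P (true , l₀₂ , l₁₂) f {1} {0} refl =
    sym (mergeIf-refines l₁₂ _ _ _ (mergeIf-refines l₀₂ _ _ _ (merge-joins f (corner P 0) (corner P 1))))
  mergeLinks-joins P (l₀₁ , true , l₁₂) f {0} {2} refl =
    mergeIf-refines l₁₂ _ _ _ (merge-joins (mergeIf l₀₁ (corner P 0) (corner P 1) f) (corner P 0) (corner P 2))
  mergeLinks-joins P (l₀₁ , true , l₁₂) f {2} {0} refl =
    sym (mergeIf-refines l₁₂ _ _ _ (merge-joins (mergeIf l₀₁ (corner P 0) (corner P 1) f) (corner P 0) (corner P 2)))
  mergeLinks-joins P (l₀₁ , l₀₂ , true) f {1} {2} refl =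
    merge-joins (mergeIf l₀₂ (corner P 0) (corner P 2) (mergeIf l₀₁ (corner P 0) (corner P 1) f)) (corner P 1) (corner P 2)
  mergeLinks-joins P (l₀₁ , l₀₂ , true) f {2} {1} refl =
    sym (merge-joins (mergeIf l₀₂ (corner P 0) (corner P 2) (mergeIf l₀₁ (corner P 0) (corner P 1) f)) (corner P 1) (corner P 2))

  module Glued (k : ℕ) (gX gY gZ : List Edge) (below : PiecesBelow (3 + k) (gX , gY , gZ)) where

    g : Pieces
    g = (gX , gY , gZ)

    glued : List Edge
    glued = glue k g

    σ : Profile
    σ = mapTriple cornerLinks g

    label : Labelling
    label = gluedLabel σ

    liftWalk : ∀ P {a b} → Walk (g ! P) a b → Walk glued (embed P k a) (embed P k b)
    liftWalk P w = walk-mono (piece⊆glue k g P) (walk-map (embed P k) w)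

    liftCornerWalk : ∀ P {i j} → i < 3 → j < 3 → Walk (g ! P) i j → Walk glued (corner P i) (corner P j)
    liftCornerWalk P i<3 j<3 w = subst₂ (Walk glued) (embed-corner P k i<3) (embed-corner P k j<3) (liftWalk P w)

    WalkToLabel : Labelling → Set
    WalkToLabel f = ∀ u → Walk glued u (f u)

    merge-WalkToLabel : ∀ f {a b} → WalkToLabel f → Walk glued a b → WalkToLabel (merge f a b)
    merge-WalkToLabel f {a} {b} toLabel ab u with f u ≡ᵇ f b in same
    ... | true = toLabel u ++ʷ subst (Walk glued (f u)) (≡ᵇ-true⁻ same) nil ++ʷ walk-reverse (toLabel b)
                 ++ʷ walk-reverse ab ++ʷ toLabel a
    ... | false = toLabel u

    mergeLinks-WalkToLabel : ∀ P f → WalkToLabel f → WalkToLabel (mergeLinks P (cornerLinks (g ! P)) f)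
    mergeLinks-WalkToLabel P f toLabel =
      mergeIf-WTL (s≤s (s≤s z≤n)) (s≤s (s≤s (s≤s z≤n)))
        (mergeIf-WTL (s≤s z≤n) (s≤s (s≤s (s≤s z≤n)))
          (mergeIf-WTL (s≤s z≤n) (s≤s (s≤s z≤n)) toLabel))
      where
      mergeIf-WTL : ∀ {i j f′} → i < 3 → j < 3 → WalkToLabel f′ →
                    WalkToLabel (mergeIf (conn (g ! P) i j) (corner P i) (corner P j) f′)
      mergeIf-WTL {i} {j} {f′} i<3 j<3 toLabel′ with conn (g ! P) i j in ij
      ... | true = merge-WalkToLabel f′ toLabel′ (liftCornerWalk P i<3 j<3 (conn⇒Walk ij))
      ... | false = toLabel′

    walkToLabel : WalkToLabel label
    walkToLabel = mergeLinks-WalkToLabel Z _ (mergeLinks-WalkToLabel Y _ (mergeLinks-WalkToLabel X _ (λ u → nil)))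

    sameLabel⇒Walk : ∀ {u v} → label u ≡ label v → Walk glued u v
    sameLabel⇒Walk {u} {v} eq = walkToLabel u ++ʷ subst (λ z → Walk glued z v) (sym eq) (walk-reverse (walkToLabel v))

    pieceWalk⇒sameLabel : ∀ P {i j} → i < 3 → j < 3 → Walk (g ! P) i j → label (corner P i) ≡ label (corner P j)
    pieceWalk⇒sameLabel X {i} {j} i<3 j<3 w =
      mergeLinks-refines Z (cornerLinks gZ) _ (mergeLinks-refines Y (cornerLinks gY) _
        (mergeLinks-joins X (cornerLinks gX) (λ u → u) {i} {j} (trans (linked-cornerLinks gX i<3 j<3) (Walk⇒conn w))))
    pieceWalk⇒sameLabel Y {i} {j} i<3 j<3 w =
      mergeLinks-refines Z (cornerLinks gZ) _
        (mergeLinks-joins Y (cornerLinks gY) _ {i} {j} (trans (linked-cornerLinks gY i<3 j<3) (Walk⇒conn w)))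
    pieceWalk⇒sameLabel Z {i} {j} i<3 j<3 w =
      mergeLinks-joins Z (cornerLinks gZ) _ {i} {j} (trans (linked-cornerLinks gZ i<3 j<3) (Walk⇒conn w))

    -- Connectivity in the glued graph, described piecewise: vertex a of copy P reaches vertex b
    -- of copy Q inside P, or through two corners carrying the same label.
    ViaCorners : Piece → ℕ → Piece → ℕ → Set
    ViaCorners P a Q b = ∃ λ p → ∃ λ q → p < 3 × q < 3 × Walk (g ! P) a p × Walk (g ! Q) q b
                                       × label (corner P p) ≡ label (corner Q q)

    Linked : Piece → ℕ → Piece → ℕ → Set
    Linked P a Q b = (Σ (P ≡ Q) λ { refl → Walk (g ! P) a b }) ⊎ ViaCorners P a Q b

    Linked-extend : ∀ {P a Q b d} → Linked P a Q b → Step (g ! Q) b d → Linked P a Q d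
    Linked-extend (inj₁ (refl , w)) s = inj₁ (refl , snoc w s)
    Linked-extend (inj₂ (p , q , p<3 , q<3 , ap , qb , eq)) s = inj₂ (p , q , p<3 , q<3 , ap , snoc qb s , eq)

    Linked-transport : ∀ {P a Q′ b′ Q b} → b′ < 3 + k → b < 3 + k → embed Q′ k b′ ≡ embed Q k b →
                       Linked P a Q′ b′ → Linked P a Q b
    Linked-transport {Q′ = Q′} {b′} {Q} {b} b′< b< eq r with embed-injective Q′ Q k b′< b< eq
    ... | inj₁ (refl , refl) = r
    ... | inj₂ (b′<3 , b<3) with r
    ... | inj₁ (refl , w) = inj₂ (b′ , b , b′<3 , b<3 , w , nil , cong label sameCorner)
      where sameCorner = trans (sym (embed-corner Q′ k b′<3)) (trans eq (embed-corner Q k b<3))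
    ... | inj₂ (p , q , p<3 , q<3 , ap , qb′ , eq′) =
      inj₂ (p , b , p<3 , b<3 , ap , nil , trans eq′ (trans (pieceWalk⇒sameLabel Q′ q<3 b′<3 qb′) (cong label sameCorner)))
      where sameCorner = trans (sym (embed-corner Q′ k b′<3)) (trans eq (embed-corner Q k b<3))

    glued-step : ∀ {u v} → Step glued u v → ∃ λ Q → ∃ λ c → ∃ λ d →
                 c < 3 + k × d < 3 + k × Step (g ! Q) c d × u ≡ embed Q k c × v ≡ embed Q k d
    glued-step (fwd e) with ∈-glue⁻ k g e
    ... | Q , (c , d , _) , e₀ , refl = Q , c , d , proj₁ (below Q e₀) , proj₂ (below Q e₀) , fwd e₀ , refl , refl
    glued-step (bwd e) with ∈-glue⁻ k g e
    ... | Q , (c , d , _) , e₀ , refl = Q , d , c , proj₂ (below Q e₀) , proj₁ (below Q e₀) , bwd e₀ , refl , refl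

    Walk⇒Linked′ : ∀ P {a} → a < 3 + k → ∀ {v} → Walk glued (embed P k a) v →
                   ∃ λ Q → ∃ λ b → b < 3 + k × v ≡ embed Q k b × Linked P a Q b
    Walk⇒Linked′ P {a} a< nil = P , a , a< , refl , inj₁ (refl , nil)
    Walk⇒Linked′ P a< (snoc w s) with Walk⇒Linked′ P a< w | glued-step s
    ... | Q , b , b< , refl , r | Q′ , c , d , c< , d< , s′ , eq , refl =
      Q′ , d , d< , refl , Linked-extend (Linked-transport b< c< eq r) s′

    Walk⇒Linked : ∀ P Q {a b} → a < 3 + k → b < 3 + k → Walk glued (embed P k a) (embed Q k b) → Linked P a Q b
    Walk⇒Linked P Q a< b< w with Walk⇒Linked′ P a< w
    ... | Q′ , b′ , b′< , eq , r = Linked-transport b′< b< (sym eq) r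

    Linked⇒Walk : ∀ P Q {a b} → Linked P a Q b → Walk glued (embed P k a) (embed Q k b)
    Linked⇒Walk P Q (inj₁ (refl , w)) = liftWalk P w
    Linked⇒Walk P Q {a} {b} (inj₂ (p , q , p<3 , q<3 , ap , qb , eq)) =
      subst (Walk glued (embed P k a)) (embed-corner P k p<3) (liftWalk P ap)
      ++ʷ sameLabel⇒Walk eq
      ++ʷ subst (λ z → Walk glued z (embed Q k b)) (embed-corner Q k q<3) (liftWalk Q qb)

    conn-corners : ∀ P Q {i j} → i < 3 → j < 3 → conn glued (corner P i) (corner Q j) ≡ (label (corner P i) ≡ᵇ label (corner Q j))
    conn-corners P Q {i} {j} i<3 j<3 = Bool-ext to (λ same → Walk⇒conn (sameLabel⇒Walk (≡ᵇ-true⁻ same)))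
      where
      <3+k : ∀ {x} → x < 3 → x < 3 + k
      <3+k x<3 = <-≤-trans x<3 (m≤m+n 3 k)
      to : conn glued (corner P i) (corner Q j) ≡ true → (label (corner P i) ≡ᵇ label (corner Q j)) ≡ true
      to c with Walk⇒Linked P Q (<3+k i<3) (<3+k j<3)
                  (subst₂ (Walk glued) (sym (embed-corner P k i<3)) (sym (embed-corner Q k j<3)) (conn⇒Walk c))
      ... | inj₁ (refl , w) rewrite pieceWalk⇒sameLabel P i<3 j<3 w = ≡ᵇ-refl (label (corner P j))
      ... | inj₂ (p , q , p<3 , q<3 , ip , qj , eq)
        rewrite pieceWalk⇒sameLabel P i<3 p<3 ip | eq | pieceWalk⇒sameLabel Q q<3 j<3 qj = ≡ᵇ-refl (label (corner Q j))

    conn-embed-separated : ∀ P {x y} → x < 3 + k → y < 3 + k → conn (g ! P) x y ≡ false →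
      conn glued (embed P k x) (embed P k y) ≡ joinedOutside σ P (reachedCorners (g ! P) x) (reachedCorners (g ! P) y)
    conn-embed-separated P {x} {y} x< y< x≁y =
      Bool-ext to from
      where
      G = g ! P
      Sx = reachedCorners G x
      Sy = reachedCorners G y
      viaPair : ℕ → ℕ → Bool
      viaPair p q = Sx ∋ᶜ p ∧ Sy ∋ᶜ q ∧ (label (corner P p) ≡ᵇ label (corner P q))
      to : conn glued (embed P k x) (embed P k y) ≡ true → joinedOutside σ P Sx Sy ≡ true
      to c with Walk⇒Linked P P x< y< (conn⇒Walk c)
      ... | inj₁ (refl , w) = contradiction (Walk⇒conn w) (λ c′ → false≢true (trans (sym x≁y) c′))
      ... | inj₂ (p , q , p<3 , q<3 , xp , qy , eq) =
        anyB-true⁺ (λ p′ → anyB (viaPair p′) corners) corners (<3⇒∈corners p<3)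
          (anyB-true⁺ (viaPair p) corners (<3⇒∈corners q<3)
            (subst₂ (λ u v → (u ∧ v ∧ (label (corner P p) ≡ᵇ label (corner P q))) ≡ true)
              (sym (reachedCorners-∋ G x p<3)) (sym (reachedCorners-∋ G y q<3))
              (∧-true⁺ (Walk⇒conn xp) (∧-true⁺ (Walk⇒conn (walk-reverse qy))
                (subst (λ z → (label (corner P p) ≡ᵇ z) ≡ true) eq (≡ᵇ-refl (label (corner P p))))))))
      from : joinedOutside σ P Sx Sy ≡ true → conn glued (embed P k x) (embed P k y) ≡ true
      from h with anyB-true⁻ (λ p′ → anyB (viaPair p′) corners) corners h
      ... | p , p∈ , h′ with anyB-true⁻ (viaPair p) corners h′
      ... | q , q∈ , pq with ∧-true⁻ {Sx ∋ᶜ p} pq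
      ... | xp , pq′ with ∧-true⁻ {Sy ∋ᶜ q} pq′
      ... | yq , eq = Walk⇒conn (Linked⇒Walk P P (inj₂ (p , q , ∈corners⇒<3 p∈ , ∈corners⇒<3 q∈ ,
            conn⇒Walk (trans (sym (reachedCorners-∋ G x (∈corners⇒<3 p∈))) xp) ,
            walk-reverse (conn⇒Walk (trans (sym (reachedCorners-∋ G y (∈corners⇒<3 q∈))) yq)) , ≡ᵇ-true⁻ eq)))

module GluedForests where

  open Booleans
  open Walks
  open Forests using (isForest-∷)
  open Gluing
  open CornerAbstraction
  open GluedConnectivity
  open import Data.Nat using (ℕ; _<_; _+_)
  open import Data.Bool using (Bool; true; false; _∧_; not)
  open import Data.Bool.Properties using (∧-zeroʳ; ∧-identityʳ; ∧-assoc)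
  open import Data.List using (List; []; _∷_)
  open import Data.List.Relation.Unary.Any using (here; there)
  open import Data.Product using (_,_; proj₁; proj₂)
  open import Relation.Binary.PropositionalEquality

  allForests : Pieces → Bool
  allForests (a , b , c) = isForest a ∧ isForest b ∧ isForest c

  otherForests : Pieces → Piece → Bool
  otherForests (a , b , c) X = isForest b ∧ isForest c
  otherForests (a , b , c) Y = isForest a ∧ isForest c
  otherForests (a , b , c) Z = isForest a ∧ isForest b

  allForests-split : ∀ g P → allForests g ≡ isForest (g ! P) ∧ otherForests g P
  allForests-split (a , b , c) X = refl
  allForests-split (a , b , c) Y with isForest a
  ... | true = refl
  ... | false = sym (∧-zeroʳ (isForest b))
  allForests-split (a , b , c) Z with isForest a | isForest b
  ... | true | true = sym (∧-identityʳ (isForest c))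
  ... | true | false = sym (∧-zeroʳ (isForest c))
  ... | false | _ = sym (∧-zeroʳ (isForest c))

  otherForests-update : ∀ g P G → otherForests (update g P G) P ≡ otherForests g P
  otherForests-update (a , b , c) X G = refl
  otherForests-update (a , b , c) Y G = refl
  otherForests-update (a , b , c) Z G = refl

  private
    reshuffle : ∀ f r h d n h′ → (n ≡ true → d ≡ true) → (n ≡ false → h′ ≡ h ∧ not d) →
                ((f ∧ r) ∧ h) ∧ not d ≡ ((f ∧ not n) ∧ r) ∧ h′
    reshuffle f r h d true h′ n⇒d _ rewrite n⇒d refl | ∧-zeroʳ f | ∧-zeroʳ ((f ∧ r) ∧ h) = refl
    reshuffle f r h d false h′ _ h′≡ rewrite h′≡ refl | ∧-identityʳ f = ∧-assoc (f ∧ r) h (not d)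

  module _ (k : ℕ) (gX gY gZ : List Edge) (below : PiecesBelow (3 + k) (gX , gY , gZ)) where
    open Glued k gX gY gZ below

    isForest-glue-∷ : ∀ P {x y} l → x < 3 + k → y < 3 + k →
      isForest glued ≡ allForests g ∧ acyclicGluing σ →
      isForest (mapEdge (embed P k) (x , y , l) ∷ glued)
        ≡ allForests (update g P ((x , y , l) ∷ g ! P)) ∧ acyclicGluing (mapTriple cornerLinks (update g P ((x , y , l) ∷ g ! P)))
    isForest-glue-∷ P {x} {y} l x< y< ih =
      begin
        isForest (mapEdge (embed P k) (x , y , l) ∷ glued)
      ≡⟨ isForest-∷ glued (embed P k x) (embed P k y) l ⟩
        isForest glued ∧ not joined
      ≡⟨ cong (λ b → b ∧ not joined) (trans ih (cong (_∧ acyclicGluing σ) (allForests-split g P))) ⟩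
        ((isForest G ∧ otherForests g P) ∧ acyclicGluing σ) ∧ not joined
      ≡⟨ reshuffle (isForest G) (otherForests g P) (acyclicGluing σ) joined (conn G x y) (acyclicGluing σ′)
                   (λ c → Walk⇒conn (liftWalk P (conn⇒Walk c))) acyclic-after ⟩
        ((isForest G ∧ not (conn G x y)) ∧ otherForests g P) ∧ acyclicGluing σ′
      ≡⟨ cong (_∧ acyclicGluing σ′) (sym forests-after) ⟩
        allForests g′ ∧ acyclicGluing σ′
      ∎
      where
      open ≡-Reasoning
      G = g ! P
      Sx = reachedCorners G x
      Sy = reachedCorners G y
      g′ = update g P ((x , y , l) ∷ G)
      σ′ = mapTriple cornerLinks g′
      joined = conn glued (embed P k x) (embed P k y)
      forests-after : allForests g′ ≡ (isForest G ∧ not (conn G x y)) ∧ otherForests g P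
      forests-after = trans (allForests-split g′ P)
        (cong₂ _∧_ (trans (cong isForest (update-! g P _)) (isForest-∷ G x y l)) (otherForests-update g P _))
      acyclic-after : conn G x y ≡ false → acyclicGluing σ′ ≡ acyclicGluing σ ∧ not joined
      acyclic-after x≁y =
        begin
          acyclicGluing σ′
        ≡⟨ cong acyclicGluing (trans (mapTriple-update cornerLinks g P _)
             (cong (update σ P) (trans (cornerLinks-∷ G x y l) (cong (λ t → linksAfterEdge t Sx Sy) (sym (mapTriple-! cornerLinks g P)))))) ⟩
          acyclicGluing (update σ P (linksAfterEdge (σ ! P) Sx Sy))
        ≡⟨ addEdgeSound-at P Sx Sy (cornerLinks∈partitions gX) (cornerLinks∈partitions gY) (cornerLinks∈partitions gZ)
             (subst (λ t → reachSetsConsistent t Sx Sy ≡ true) (sym (mapTriple-! cornerLinks g P))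
               (reachSetsConsistent-holds G x y x≁y)) ⟩
          acyclicGluing σ ∧ not (joinedOutside σ P Sx Sy)
        ≡⟨ cong (λ b → acyclicGluing σ ∧ not b) (sym (conn-embed-separated P x< y< x≁y)) ⟩
          acyclicGluing σ ∧ not joined
        ∎

  -- Adding the edges of X, then Y, then Z keeps the new edge at the head of the glued edge list.
  isForest-glue : ∀ k g → PiecesBelow (3 + k) g → isForest (glue k g) ≡ allForests g ∧ acyclicGluing (mapTriple cornerLinks g)
  isForest-glue k ((x , y , l) ∷ gX , gY , gZ) below =
    isForest-glue-∷ k gX gY gZ below′ X l (proj₁ (below X (here refl))) (proj₂ (below X (here refl)))
      (isForest-glue k (gX , gY , gZ) below′)
    where below′ = λ { X e → below X (there e) ; Y e → below Y e ; Z e → below Z e }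
  isForest-glue k ([] , (x , y , l) ∷ gY , gZ) below =
    isForest-glue-∷ k [] gY gZ below′ Y l (proj₁ (below Y (here refl))) (proj₂ (below Y (here refl)))
      (isForest-glue k ([] , gY , gZ) below′)
    where below′ = λ { X e → below X e ; Y e → below Y (there e) ; Z e → below Z e }
  isForest-glue k ([] , [] , (x , y , l) ∷ gZ) below =
    isForest-glue-∷ k [] [] gZ below′ Z l (proj₁ (below Z (here refl))) (proj₂ (below Z (here refl)))
      (isForest-glue k ([] , [] , gZ) below′)
    where below′ = λ { X e → below X e ; Y e → below Y e ; Z e → below Z (there e) }
  isForest-glue k ([] , [] , []) below = sym acyclicGluing-empty

module ForestKinds where

  open Booleans
  open Components
  open CornerAbstraction
  open GluedConnectivity using (cornerLinks; cornerLinks∈partitions)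
  open import Data.Nat using (ℕ; _≡ᵇ_; _≤ᵇ_; _≤_; _<_; z≤n; s≤s; _+_)
  open import Data.Nat.Properties using (≤⇒≤ᵇ)
  open import Data.Bool using (Bool; true; false; _∧_; not; if_then_else_)
  open import Data.List using (List; []; _∷_; cartesianProduct)
  open import Data.List.Membership.Propositional using (_∈_)
  open import Data.List.Membership.Propositional.Properties using (∈-cartesianProduct⁺)
  open import Data.List.Relation.Unary.Any using (here; there)
  open import Data.Maybe using (Maybe; just; nothing)
  open import Data.Fin using (Fin; toℕ; #_)
  open import Data.Product using (_×_; _,_; ∃; proj₁; proj₂)
  open import Relation.Nullary using (contradiction)
  open import Data.Bool.Properties using (T-≡)
  open import Function.Bundles using (Equivalence)
  open import Relation.Binary.PropositionalEquality

  data Kind : Set where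
    kT kU kR kL kQ : Kind

  allKinds : List Kind
  allKinds = kT ∷ kU ∷ kR ∷ kL ∷ kQ ∷ []

  ∈-allKinds : ∀ κ → κ ∈ allKinds
  ∈-allKinds kT = here refl
  ∈-allKinds kU = there (here refl)
  ∈-allKinds kR = there (there (here refl))
  ∈-allKinds kL = there (there (there (here refl)))
  ∈-allKinds kQ = there (there (there (there (here refl))))

  linksOf : Kind → CornerLinks
  linksOf kT = (true , true , true)
  linksOf kU = (false , false , true)
  linksOf kR = (true , false , false)
  linksOf kL = (false , true , false)
  linksOf kQ = (false , false , false)

  condition : Kind → CornerLinks → Bool
  condition kT _ = true
  condition kU (l₀₁ , l₀₂ , l₁₂) = l₁₂ ∧ not l₀₁
  condition kR (l₀₁ , l₀₂ , l₁₂) = l₀₁ ∧ not l₀₂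
  condition kL (l₀₁ , l₀₂ , l₁₂) = l₀₂ ∧ not l₀₁
  condition kQ (l₀₁ , l₀₂ , l₁₂) = not l₀₁ ∧ not l₀₂ ∧ not l₁₂

  componentCount : Kind → ℕ
  componentCount κ = blocks (linksOf κ)

  -- The spanning forests counted by T, U, R, L, Q respectively (definitionally the predicates of Tg, …, Qg).
  CountedBy : Kind → ℕ → List Edge → Bool
  CountedBy κ nv F = isForest F ∧ (components nv F ≡ᵇ componentCount κ) ∧ condition κ (cornerLinks F)

  kindOfLinks : CornerLinks → Maybe Kind
  kindOfLinks (true , true , true) = just kT
  kindOfLinks (false , false , true) = just kU
  kindOfLinks (true , false , false) = just kR
  kindOfLinks (false , true , false) = just kL
  kindOfLinks (false , false , false) = just kQ
  kindOfLinks _ = nothing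

  kindOfLinks-partition : ∀ {t} → t ∈ partitions → ∃ λ κ → kindOfLinks t ≡ just κ × linksOf κ ≡ t
  kindOfLinks-partition (here refl) = kT , refl , refl
  kindOfLinks-partition (there (here refl)) = kR , refl , refl
  kindOfLinks-partition (there (there (here refl))) = kL , refl , refl
  kindOfLinks-partition (there (there (there (here refl)))) = kU , refl , refl
  kindOfLinks-partition (there (there (there (there (here refl))))) = kQ , refl , refl

  -- The kind of a spanning subgraph of a copy is defined only when it is a forest each of
  -- whose components contains a corner, the only case that occurs inside a counted forest of Γ (n + 1).
  Minimal : ℕ → List Edge → Bool
  Minimal nv s = isForest s ∧ (components nv s ≡ᵇ blocks (cornerLinks s))

  kind : ℕ → List Edge → Maybe Kind
  kind nv s = if Minimal nv s then kindOfLinks (cornerLinks s) else nothing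

  Minimal⁺ : ∀ {nv s} → isForest s ≡ true → blocks (cornerLinks s) ≡ components nv s → Minimal nv s ≡ true
  Minimal⁺ {s = s} forest eq = ∧-true⁺ forest (subst (λ n → (n ≡ᵇ blocks (cornerLinks s)) ≡ true) eq (≡ᵇ-refl (blocks (cornerLinks s))))

  Minimal⇒kind≡ : ∀ nv s → Minimal nv s ≡ true → kind nv s ≡ kindOfLinks (cornerLinks s)
  Minimal⇒kind≡ nv s minimal rewrite minimal = refl

  Minimal⇒kind-just : ∀ nv s → Minimal nv s ≡ true → ∃ λ κ → kind nv s ≡ just κ × linksOf κ ≡ cornerLinks s
  Minimal⇒kind-just nv s minimal rewrite minimal = kindOfLinks-partition (cornerLinks∈partitions s)

  kind-just⇒Minimal : ∀ nv s {κ} → kind nv s ≡ just κ → Minimal nv s ≡ true × linksOf κ ≡ cornerLinks s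
  kind-just⇒Minimal nv s eq with Minimal nv s in minimal
  ... | true with kindOfLinks-partition (cornerLinks∈partitions s)
  ... | κ , eq′ , links rewrite eq′ with eq
  ... | refl = refl , links

  blocks≤components : ∀ k s → blocks (cornerLinks s) ≤ components (3 + k) s
  blocks≤components k s = bound (cornerLinks s) refl
    where
    0< : 0 < 3 + k
    0< = s≤s z≤n
    1< : 1 < 3 + k
    1< = s≤s (s≤s z≤n)
    2< : 2 < 3 + k
    2< = s≤s (s≤s (s≤s z≤n))
    bound : ∀ t → cornerLinks s ≡ t → blocks t ≤ components (3 + k) s
    bound (true , true , _) _ = components≥1 (3 + k) s 0 0<
    bound (true , false , true) _ = components≥1 (3 + k) s 0 0<
    bound (true , false , false) eq = components≥2 (3 + k) s 0 2 0< 2< (cong (λ t → proj₁ (proj₂ t)) eq)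
    bound (false , true , _) eq = components≥2 (3 + k) s 0 1 0< 1< (cong proj₁ eq)
    bound (false , false , true) eq = components≥2 (3 + k) s 0 1 0< 1< (cong proj₁ eq)
    bound (false , false , false) eq =
      components≥3 (3 + k) s 0 1 2 0< 1< 2< (cong proj₁ eq) (cong (λ t → proj₁ (proj₂ t)) eq) (cong (λ t → proj₂ (proj₂ t)) eq)

  kinds : List (Maybe Kind)
  kinds = just kT ∷ just kU ∷ just kR ∷ just kL ∷ just kQ ∷ nothing ∷ []

  kindIndex : Maybe Kind → Fin 6
  kindIndex (just kT) = # 0
  kindIndex (just kU) = # 1
  kindIndex (just kR) = # 2
  kindIndex (just kL) = # 3
  kindIndex (just kQ) = # 4
  kindIndex nothing = # 5

  sameKind : Maybe Kind → Maybe Kind → Bool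
  sameKind m m′ = toℕ (kindIndex m) ≡ᵇ toℕ (kindIndex m′)

  isKind : Kind → Maybe Kind → Bool
  isKind κ m = sameKind m (just κ)

  isKind-nothing : ∀ κ → isKind κ nothing ≡ false
  isKind-nothing kT = refl
  isKind-nothing kU = refl
  isKind-nothing kR = refl
  isKind-nothing kL = refl
  isKind-nothing kQ = refl

  -- A forest satisfying the condition of κ with at most componentCount κ components has the corner
  -- partition of κ, and conversely.
  conditionForcesKind kindForcesCondition : Kind × CornerLinks → Bool
  conditionForcesKind (κ , t) =
    (condition κ t ∧ (blocks t ≤ᵇ componentCount κ)) ⇒ᵇ (isKind κ (kindOfLinks t) ∧ (blocks t ≡ᵇ componentCount κ))
  kindForcesCondition (κ , t) = isKind κ (kindOfLinks t) ⇒ᵇ (condition κ t ∧ (blocks t ≡ᵇ componentCount κ))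

  conditionForcesKind-holds : allB conditionForcesKind (cartesianProduct allKinds partitions) ≡ true
  conditionForcesKind-holds = refl

  kindForcesCondition-holds : allB kindForcesCondition (cartesianProduct allKinds partitions) ≡ true
  kindForcesCondition-holds = refl

  CountedBy≡isKind : ∀ κ k s → CountedBy κ (3 + k) s ≡ isKind κ (kind (3 + k) s)
  CountedBy≡isKind κ k s = Bool-ext to from
    where
    t = cornerLinks s
    c = components (3 + k) s
    j = componentCount κ
    κt∈ : (κ , t) ∈ cartesianProduct allKinds partitions
    κt∈ = ∈-cartesianProduct⁺ (∈-allKinds κ) (cornerLinks∈partitions s)
    forces : conditionForcesKind (κ , t) ≡ true
    forces = allB-true⁻ conditionForcesKind _ conditionForcesKind-holds κt∈
    forced : kindForcesCondition (κ , t) ≡ true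
    forced = allB-true⁻ kindForcesCondition _ kindForcesCondition-holds κt∈
    to : CountedBy κ (3 + k) s ≡ true → isKind κ (kind (3 + k) s) ≡ true
    to h with ∧-true⁻ {isForest s} h
    ... | forest , h′ with ∧-true⁻ {c ≡ᵇ j} h′
    ... | count , cond with ∧-true⁻ {isKind κ (kindOfLinks t)} (⇒ᵇ-true⁻ forces
           (∧-true⁺ cond (Equivalence.to T-≡ (≤⇒≤ᵇ (subst (blocks t ≤_) (≡ᵇ-true⁻ {c} {j} count) (blocks≤components k s))))))
    ... | isκ , blocks≡ = subst (λ m → isKind κ m ≡ true) (sym (Minimal⇒kind≡ (3 + k) s minimal)) isκ
      where
      minimal : Minimal (3 + k) s ≡ true
      minimal = Minimal⁺ {3 + k} {s} forest (trans (≡ᵇ-true⁻ {blocks t} {j} blocks≡) (sym (≡ᵇ-true⁻ {c} {j} count)))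
    from : isKind κ (kind (3 + k) s) ≡ true → CountedBy κ (3 + k) s ≡ true
    from h with Minimal (3 + k) s in minimal
    ... | false = contradiction (trans (sym h) (isKind-nothing κ)) (λ ())
    ... | true with ∧-true⁻ {isForest s} minimal | ∧-true⁻ {condition κ t} (⇒ᵇ-true⁻ forced h)
    ... | forest , count | cond , blocks≡ =
      ∧-true⁺ forest (∧-true⁺ (subst (λ n → (n ≡ᵇ j) ≡ true)
        (sym (trans (≡ᵇ-true⁻ {c} {blocks t} count) (≡ᵇ-true⁻ {blocks t} {j} blocks≡))) (≡ᵇ-refl j)) cond)

module Classification where

  open Booleans
  open Components
  open Gluing
  open CornerAbstraction
  open GluedConnectivity
  open GluedForests
  open ForestKinds
  open import Data.Nat using (ℕ; _≡ᵇ_; _≤ᵇ_; _≤_; z≤n; s≤s; _+_)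
  open import Data.Nat.Properties
    using (+-assoc; +-cancelʳ-≡; ≤ᵇ⇒≤; m≤n⇒m<n∨m≡n; <⇒≱; +-mono-<-≤; +-mono-≤)
  open import Data.Nat.Tactic.RingSolver using (solve-∀)
  open import Data.Bool using (Bool; true; false; _∧_)
  open import Data.Bool.Properties using (T-≡)
  open import Data.List using (List; _++_; map; length; cartesianProduct)
  open import Data.List.Properties using (length-++; length-map)
  open import Data.List.Membership.Propositional.Properties using (∈-cartesianProduct⁺)
  open import Data.Maybe using (Maybe; just)
  open import Data.Product using (_×_; _,_; Σ; proj₁; proj₂)
  open import Data.Sum using (inj₁; inj₂)
  open import Function.Bundles using (Equivalence)
  open import Relation.Nullary using (contradiction)
  open import Relation.Binary.PropositionalEquality

  kindProfile : Kind → Kind → Kind → Profile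
  kindProfile a b c = (linksOf a , linksOf b , linksOf c)

  gluedCondition : Kind → Profile → Bool
  gluedCondition κ σ = condition κ ((label 0 ≡ᵇ label 1) , (label 0 ≡ᵇ label 2) , (label 1 ≡ᵇ label 2))
    where label = gluedLabel σ

  -- Copies of kinds a, b, c glue to a forest counted by κ.
  admissible : Kind → Maybe Kind → Maybe Kind → Maybe Kind → Bool
  admissible κ (just a) (just b) (just c) =
    acyclicGluing σ ∧ (totalBlocks σ ≡ᵇ componentCount κ + 3) ∧ gluedCondition κ σ
    where σ = kindProfile a b c
  admissible κ _ _ _ = false

  AdmissibleProfile : Kind → Profile → Set
  AdmissibleProfile κ σ = acyclicGluing σ ≡ true × (totalBlocks σ ≡ᵇ componentCount κ + 3) ≡ true × gluedCondition κ σ ≡ true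

  admissible-just⁻ : ∀ κ {ma mb mc} → admissible κ ma mb mc ≡ true →
    Σ Kind λ a → Σ Kind λ b → Σ Kind λ c → ma ≡ just a × mb ≡ just b × mc ≡ just c × AdmissibleProfile κ (kindProfile a b c)
  admissible-just⁻ κ {just a} {just b} {just c} h =
    let acyclic , rest = ∧-true⁻ {acyclicGluing (kindProfile a b c)} h
        total , cond = ∧-true⁻ {totalBlocks (kindProfile a b c) ≡ᵇ componentCount κ + 3} rest
    in a , b , c , refl , refl , refl , acyclic , total , cond

  admissible-just⁺ : ∀ κ {a b c} → AdmissibleProfile κ (kindProfile a b c) → admissible κ (just a) (just b) (just c) ≡ true
  admissible-just⁺ κ (acyclic , total , cond) = ∧-true⁺ acyclic (∧-true⁺ total cond)

  -- Gluing merges components only through the corners, so a forest counted by κ needs at least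
  -- componentCount κ + 3 corner blocks in its three copies; Euler's formula shows it has exactly that
  -- many components in the copies, hence every copy is minimal.
  enoughBlocks : Kind × Profile → Bool
  enoughBlocks (κ , σ) = (acyclicGluing σ ∧ gluedCondition κ σ) ⇒ᵇ (componentCount κ + 3 ≤ᵇ totalBlocks σ)

  opaque
    unfolding acyclicGluing

    enoughBlocks-holds :
      allB enoughBlocks (cartesianProduct allKinds (cartesianProduct partitions (cartesianProduct partitions partitions))) ≡ true
    enoughBlocks-holds = refl

  blocks-tight : ∀ {a a′ b b′ c c′} → a ≤ a′ → b ≤ b′ → c ≤ c′ → a′ + b′ + c′ ≤ a + b + c → a ≡ a′ × b ≡ b′ × c ≡ c′
  blocks-tight {a} {a′} {b} {b′} {c} {c′} a≤ b≤ c≤ sum≤ =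
    first a≤ b≤ c≤ sum≤ ,
    first b≤ a≤ c≤ (subst₂ _≤_ (swap a′ b′ c′) (swap a b c) sum≤) ,
    first c≤ a≤ b≤ (subst₂ _≤_ (rotate a′ b′ c′) (rotate a b c) sum≤)
    where
    first : ∀ {x x′ y y′ z z′} → x ≤ x′ → y ≤ y′ → z ≤ z′ → x′ + y′ + z′ ≤ x + y + z → x ≡ x′
    first x≤ y≤ z≤ le with m≤n⇒m<n∨m≡n x≤
    ... | inj₂ eq = eq
    ... | inj₁ lt = contradiction le (<⇒≱ (+-mono-<-≤ (+-mono-<-≤ lt y≤) z≤))
    swap : ∀ x y z → x + y + z ≡ y + x + z
    swap = solve-∀
    rotate : ∀ x y z → x + y + z ≡ z + x + y
    rotate = solve-∀

  module _ (k : ℕ) (sX sY sZ : List Edge) (below : PiecesBelow (3 + k) (sX , sY , sZ)) where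
    open Glued k sX sY sZ below

    private
      cX = components (3 + k) sX
      cY = components (3 + k) sY
      cZ = components (3 + k) sZ
      c = components (gluedSize k) glued

    length-glued : length glued ≡ length sX + length sY + length sZ
    length-glued rewrite length-++ (map (mapEdge (embX k)) sX) {map (mapEdge (embY k)) sY ++ map (mapEdge (embZ k)) sZ}
                       | length-++ (map (mapEdge (embY k)) sY) {map (mapEdge (embZ k)) sZ}
                       | length-map (mapEdge (embX k)) sX | length-map (mapEdge (embY k)) sY
                       | length-map (mapEdge (embZ k)) sZ = sym (+-assoc (length sX) _ _)

    glued-components : isForest glued ≡ true → isForest sX ≡ true → isForest sY ≡ true → isForest sZ ≡ true →
                       c + 3 ≡ cX + cY + cZ
    glued-components fG fX fY fZ = +-cancelʳ-≡ (ℓX + ℓY + ℓZ) _ _ (begin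
        c + 3 + (ℓX + ℓY + ℓZ)          ≡⟨ move c ⟩
        (c + length glued) + 3          ≡⟨ cong (_+ 3) (forest-components+edges (gluedSize k) glued (glue-below k g below) fG) ⟩
        gluedSize k + 3                 ≡⟨ cong (_+ 3) (gluedSize≡ k) ⟩
        6 + (k + (k + k)) + 3           ≡⟨ triple k ⟩
        (3 + k) + (3 + k) + (3 + k)     ≡⟨ sym (cong₂ _+_ (cong₂ _+_ eX eY) eZ) ⟩
        (cX + ℓX) + (cY + ℓY) + (cZ + ℓZ) ≡⟨ regroup cX cY cZ ℓX ℓY ℓZ ⟩
        cX + cY + cZ + (ℓX + ℓY + ℓZ)   ∎)
      where
      open ≡-Reasoning
      ℓX = length sX
      ℓY = length sY
      ℓZ = length sZ
      eX : cX + ℓX ≡ 3 + k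
      eX = forest-components+edges (3 + k) sX (below X) fX
      eY : cY + ℓY ≡ 3 + k
      eY = forest-components+edges (3 + k) sY (below Y) fY
      eZ : cZ + ℓZ ≡ 3 + k
      eZ = forest-components+edges (3 + k) sZ (below Z) fZ
      move : ∀ c → c + 3 + (ℓX + ℓY + ℓZ) ≡ (c + length glued) + 3
      move c rewrite length-glued = shuffle c ℓX ℓY ℓZ
        where shuffle : ∀ c x y z → c + 3 + (x + y + z) ≡ (c + (x + y + z)) + 3
              shuffle = solve-∀
      triple : ∀ k → 6 + (k + (k + k)) + 3 ≡ (3 + k) + (3 + k) + (3 + k)
      triple = solve-∀
      regroup : ∀ a b d x y z → (a + x) + (b + y) + (d + z) ≡ a + b + d + (x + y + z)
      regroup = solve-∀

    cornerLinks-glued : cornerLinks glued ≡ ((label 0 ≡ᵇ label 1) , (label 0 ≡ᵇ label 2) , (label 1 ≡ᵇ label 2))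
    cornerLinks-glued = cong₂ _,_ (conn-corners X Y (s≤s z≤n) (s≤s (s≤s z≤n)))
                          (cong₂ _,_ (conn-corners X Z (s≤s z≤n) (s≤s (s≤s (s≤s z≤n))))
                                     (conn-corners Y Z (s≤s (s≤s z≤n)) (s≤s (s≤s (s≤s z≤n)))))

    private
      kX = kind (3 + k) sX
      kY = kind (3 + k) sY
      kZ = kind (3 + k) sZ

    condition-glued : ∀ κ → condition κ (cornerLinks glued) ≡ gluedCondition κ σ
    condition-glued κ = cong (condition κ) cornerLinks-glued

    kinds-profile : ∀ {a b d} → linksOf a ≡ cornerLinks sX → linksOf b ≡ cornerLinks sY → linksOf d ≡ cornerLinks sZ →
                    kindProfile a b d ≡ σ
    kinds-profile eX eY eZ = cong₂ _,_ eX (cong₂ _,_ eY eZ)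

    CountedBy-glued⇒admissible : ∀ κ → CountedBy κ (gluedSize k) glued ≡ true → admissible κ kX kY kZ ≡ true
    CountedBy-glued⇒admissible κ h with ∧-true⁻ {isForest glued} h
    ... | fG , h′ with ∧-true⁻ {c ≡ᵇ componentCount κ} h′
    ... | count , cond with ∧-true⁻ {allForests g} (trans (sym (isForest-glue k g below)) fG)
    ... | forests , acyclic with ∧-true⁻ {isForest sX} forests
    ... | fX , fYZ with ∧-true⁻ {isForest sY} fYZ
    ... | fY , fZ =
      let a , kX≡ , eX = Minimal⇒kind-just (3 + k) sX (Minimal⁺ {3 + k} {sX} fX (proj₁ tight))
          b , kY≡ , eY = Minimal⇒kind-just (3 + k) sY (Minimal⁺ {3 + k} {sY} fY (proj₁ (proj₂ tight)))
          d , kZ≡ , eZ = Minimal⇒kind-just (3 + k) sZ (Minimal⁺ {3 + k} {sZ} fZ (proj₂ (proj₂ tight)))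
      in trans (cong₂ (λ x y → admissible κ x y kZ) kX≡ kY≡) (trans (cong (admissible κ (just a) (just b)) kZ≡)
           (admissible-just⁺ κ (subst (AdmissibleProfile κ) (sym (kinds-profile eX eY eZ)) admissibleσ)))
      where
      j = componentCount κ
      comps : cX + cY + cZ ≡ j + 3
      comps = trans (sym (glued-components fG fX fY fZ)) (cong (_+ 3) (≡ᵇ-true⁻ {c} {j} count))
      enough : j + 3 ≤ totalBlocks σ
      enough = ≤ᵇ⇒≤ (j + 3) (totalBlocks σ) (Equivalence.from T-≡ (⇒ᵇ-true⁻
        (allB-true⁻ enoughBlocks _ enoughBlocks-holds
          (∈-cartesianProduct⁺ (∈-allKinds κ) (∈-cartesianProduct⁺ (cornerLinks∈partitions sX)
            (∈-cartesianProduct⁺ (cornerLinks∈partitions sY) (cornerLinks∈partitions sZ)))))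
        (∧-true⁺ acyclic (trans (sym (condition-glued κ)) cond))))
      tight : blocks (cornerLinks sX) ≡ cX × blocks (cornerLinks sY) ≡ cY × blocks (cornerLinks sZ) ≡ cZ
      tight = blocks-tight (blocks≤components k sX) (blocks≤components k sY) (blocks≤components k sZ)
                (subst (_≤ totalBlocks σ) (sym comps) enough)
      admissibleσ : AdmissibleProfile κ σ
      admissibleσ = acyclic , trans (cong (_≡ᵇ j + 3) totalσ) (≡ᵇ-refl (j + 3)) , trans (sym (condition-glued κ)) cond
        where totalσ = trans (cong₂ _+_ (cong₂ _+_ (proj₁ tight) (proj₁ (proj₂ tight))) (proj₂ (proj₂ tight))) comps

    admissible⇒CountedBy-glued : ∀ κ → admissible κ kX kY kZ ≡ true → CountedBy κ (gluedSize k) glued ≡ true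
    admissible⇒CountedBy-glued κ h =
      let a , b , d , kX≡ , kY≡ , kZ≡ , admissibleKinds = admissible-just⁻ κ h
          mX , lX = kind-just⇒Minimal (3 + k) sX kX≡
          mY , lY = kind-just⇒Minimal (3 + k) sY kY≡
          mZ , lZ = kind-just⇒Minimal (3 + k) sZ kZ≡
          acyclic , total , cond = subst (AdmissibleProfile κ) (kinds-profile lX lY lZ) admissibleKinds
          fX , bX = ∧-true⁻ {isForest sX} mX
          fY , bY = ∧-true⁻ {isForest sY} mY
          fZ , bZ = ∧-true⁻ {isForest sZ} mZ
          fG = trans (isForest-glue k g below) (∧-true⁺ (∧-true⁺ fX (∧-true⁺ fY fZ)) acyclic)
          c≡j = +-cancelʳ-≡ 3 c j (trans (glued-components fG fX fY fZ)
                  (trans (cong₂ _+_ (cong₂ _+_ (≡ᵇ-true⁻ {cX} {blocks (cornerLinks sX)} bX) (≡ᵇ-true⁻ {cY} {blocks (cornerLinks sY)} bY))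
                                    (≡ᵇ-true⁻ {cZ} {blocks (cornerLinks sZ)} bZ))
                         (≡ᵇ-true⁻ {totalBlocks σ} {j + 3} total)))
      in ∧-true⁺ fG (∧-true⁺ (subst (λ n → (n ≡ᵇ j) ≡ true) (sym c≡j) (≡ᵇ-refl j)) (trans (condition-glued κ) cond))
      where j = componentCount κ

    CountedBy-glued : ∀ κ → CountedBy κ (gluedSize k) glued ≡ admissible κ kX kY kZ
    CountedBy-glued κ = Bool-ext (CountedBy-glued⇒admissible κ) (admissible⇒CountedBy-glued κ)

module FiniteSums where

  open import Level using (Level)
  open import Data.Bool using (Bool; true; false)
  open import Data.List using (List; []; _∷_; _++_; map; foldr)
  open import Data.List.Properties using (map-++; map-∘)
  open import Data.List.Membership.Propositional using (_∈_)
  open import Data.List.Relation.Unary.Any using (here; there)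
  open import Algebra.Bundles using (CommutativeSemiring)
  import Relation.Binary.PropositionalEquality as ≡

  subsets-map : ∀ {A B : Set} (f : A → B) xs → subsets (map f xs) ≡.≡ map (map f) (subsets xs)
  subsets-map f [] = ≡.refl
  subsets-map f (x ∷ xs) rewrite subsets-map f xs =
    ≡.trans (≡.cong (map (map f) (subsets xs) ++_) (≡.trans (≡.sym (map-∘ (subsets xs))) (map-∘ (subsets xs))))
            (≡.sym (map-++ (map f) (subsets xs) (map (x ∷_) (subsets xs))))

  module Sums {c ℓ : Level} (S : CommutativeSemiring c ℓ) where
    open CommutativeSemiring S
    open import Relation.Binary.Reasoning.Setoid setoid
    open import Algebra.Solver.Ring.NaturalCoefficients.Default S using (solve; _:*_; _:=_)

    ∑ : {A : Set} → List A → (A → Carrier) → Carrier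
    ∑ [] f = 0#
    ∑ (x ∷ xs) f = f x + ∑ xs f

    infix 10 ∑
    syntax ∑ xs (λ x → e) = ∑[ x ∈ xs ] e

    [_] : Bool → Carrier
    [ true ] = 1#
    [ false ] = 0#

    private variable A B : Set

    ∑-foldr : ∀ (xs : List A) f → foldr (λ x r → f x + r) 0# xs ≡.≡ ∑ xs f
    ∑-foldr [] f = ≡.refl
    ∑-foldr (x ∷ xs) f = ≡.cong (f x +_) (∑-foldr xs f)

    ∑-cong∈ : ∀ (xs : List A) {f g} → (∀ {x} → x ∈ xs → f x ≈ g x) → ∑ xs f ≈ ∑ xs g
    ∑-cong∈ [] _ = refl
    ∑-cong∈ (x ∷ xs) f≈g = +-cong (f≈g (here ≡.refl)) (∑-cong∈ xs (λ x∈ → f≈g (there x∈)))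

    ∑-cong : ∀ (xs : List A) {f g} → (∀ x → f x ≈ g x) → ∑ xs f ≈ ∑ xs g
    ∑-cong xs f≈g = ∑-cong∈ xs (λ {x} _ → f≈g x)

    ∑-++ : ∀ (xs ys : List A) f → ∑ (xs ++ ys) f ≈ ∑ xs f + ∑ ys f
    ∑-++ [] ys f = sym (+-identityˡ _)
    ∑-++ (x ∷ xs) ys f = trans (+-cong refl (∑-++ xs ys f)) (sym (+-assoc _ _ _))

    ∑-+ : ∀ (xs : List A) f g → ∑[ x ∈ xs ] (f x + g x) ≈ ∑ xs f + ∑ xs g
    ∑-+ [] f g = sym (+-identityˡ _)
    ∑-+ (x ∷ xs) f g = begin
      (f x + g x) + ∑[ x ∈ xs ] (f x + g x) ≈⟨ +-cong refl (∑-+ xs f g) ⟩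
      (f x + g x) + (∑ xs f + ∑ xs g)       ≈⟨ +-assoc _ _ _ ⟩
      f x + (g x + (∑ xs f + ∑ xs g))       ≈⟨ +-cong refl (trans (sym (+-assoc _ _ _)) (+-cong (+-comm _ _) refl)) ⟩
      f x + ((∑ xs f + g x) + ∑ xs g)       ≈⟨ trans (+-cong refl (+-assoc _ _ _)) (sym (+-assoc _ _ _)) ⟩
      (f x + ∑ xs f) + (g x + ∑ xs g)       ∎

    ∑-*ʳ : ∀ (xs : List A) f k → ∑ xs f * k ≈ ∑[ x ∈ xs ] (f x * k)
    ∑-*ʳ [] f k = zeroˡ k
    ∑-*ʳ (x ∷ xs) f k = trans (distribʳ k (f x) (∑ xs f)) (+-cong refl (∑-*ʳ xs f k))

    ∑-*ˡ : ∀ (xs : List A) f k → k * ∑ xs f ≈ ∑[ x ∈ xs ] (k * f x)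
    ∑-*ˡ [] f k = zeroʳ k
    ∑-*ˡ (x ∷ xs) f k = trans (distribˡ k (f x) (∑ xs f)) (+-cong refl (∑-*ˡ xs f k))

    ∑-swap : ∀ (xs : List A) (ys : List B) (f : A → B → Carrier) → ∑[ x ∈ xs ] ∑[ y ∈ ys ] f x y ≈ ∑[ y ∈ ys ] ∑[ x ∈ xs ] f x y
    ∑-swap [] ys f = sym (zero-sum ys)
      where
      zero-sum : ∀ (ys : List B) → ∑[ y ∈ ys ] 0# ≈ 0#
      zero-sum [] = refl
      zero-sum (y ∷ ys) = trans (+-identityˡ _) (zero-sum ys)
    ∑-swap (x ∷ xs) ys f = trans (+-cong refl (∑-swap xs ys f)) (sym (∑-+ ys (f x) (λ y → ∑[ x ∈ xs ] f x y)))

    ∑-map : ∀ (h : A → B) (xs : List A) f → ∑ (map h xs) f ≈ ∑[ x ∈ xs ] f (h x)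
    ∑-map h [] f = refl
    ∑-map h (x ∷ xs) f = +-cong refl (∑-map h xs f)

    ∑-subsets-++ : ∀ (xs ys : List A) (f : List A → Carrier) →
      ∑ (subsets (xs ++ ys)) f ≈ ∑[ s ∈ subsets xs ] ∑[ t ∈ subsets ys ] f (s ++ t)
    ∑-subsets-++ [] ys f = sym (+-identityʳ _)
    ∑-subsets-++ (x ∷ xs) ys f = begin
      ∑ (subsets (xs ++ ys) ++ map (x ∷_) (subsets (xs ++ ys))) f
        ≈⟨ ∑-++ (subsets (xs ++ ys)) _ f ⟩
      ∑ (subsets (xs ++ ys)) f + ∑ (map (x ∷_) (subsets (xs ++ ys))) f
        ≈⟨ +-cong (∑-subsets-++ xs ys f) (trans (∑-map (x ∷_) (subsets (xs ++ ys)) f) (∑-subsets-++ xs ys (λ u → f (x ∷ u)))) ⟩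
      ∑[ s ∈ subsets xs ] ∑[ t ∈ subsets ys ] f (s ++ t) + ∑[ s ∈ subsets xs ] ∑[ t ∈ subsets ys ] f (x ∷ s ++ t)
        ≈⟨ +-cong refl (sym (∑-map (x ∷_) (subsets xs) (λ s → ∑[ t ∈ subsets ys ] f (s ++ t)))) ⟩
      ∑[ s ∈ subsets xs ] ∑[ t ∈ subsets ys ] f (s ++ t) + ∑[ s ∈ map (x ∷_) (subsets xs) ] ∑[ t ∈ subsets ys ] f (s ++ t)
        ≈⟨ sym (∑-++ (subsets xs) _ _) ⟩
      ∑[ s ∈ subsets (x ∷ xs) ] ∑[ t ∈ subsets ys ] f (s ++ t) ∎

    ∑-subsets-map : ∀ (h : A → B) xs (f : List B → Carrier) →
      ∑ (subsets (map h xs)) f ≈ ∑[ s ∈ subsets xs ] f (map h s)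
    ∑-subsets-map h xs f = trans (reflexive (≡.cong (λ ss → ∑ ss f) (subsets-map h xs))) (∑-map (map h) (subsets xs) f)

    ∑³-factor : ∀ {A B C : Set} (xs : List A) (ys : List B) (zs : List C) (F : A → B → C → Carrier)
                (f : A → Carrier) (g : B → Carrier) (h : C → Carrier) →
      ∑[ x ∈ xs ] ∑[ y ∈ ys ] ∑[ z ∈ zs ] (F x y z * (f x * (g y * h z)))
        ≈ ∑[ x ∈ xs ] (∑[ y ∈ ys ] (∑[ z ∈ zs ] (F x y z * h z) * g y) * f x)
    ∑³-factor xs ys zs F f g h = ∑-cong xs λ x → begin
      ∑[ y ∈ ys ] ∑[ z ∈ zs ] (F x y z * (f x * (g y * h z)))
        ≈⟨ ∑-cong ys (λ y → ∑-cong zs (λ z → regroup (F x y z) (f x) (g y) (h z))) ⟩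
      ∑[ y ∈ ys ] ∑[ z ∈ zs ] (F x y z * h z * g y * f x)
        ≈⟨ ∑-cong ys (λ y → trans (sym (∑-*ʳ zs (λ z → F x y z * h z * g y) (f x)))
                                 (*-cong (sym (∑-*ʳ zs (λ z → F x y z * h z) (g y))) refl)) ⟩
      ∑[ y ∈ ys ] (∑[ z ∈ zs ] (F x y z * h z) * g y * f x)
        ≈⟨ sym (∑-*ʳ ys (λ y → ∑[ z ∈ zs ] (F x y z * h z) * g y) (f x)) ⟩
      ∑[ y ∈ ys ] (∑[ z ∈ zs ] (F x y z * h z) * g y) * f x ∎
      where
      regroup : ∀ p a b d → p * (a * (b * d)) ≈ p * d * b * a
      regroup = solve 4 (λ p a b d → p :* (a :* (b :* d)) := p :* d :* b :* a) refl

module Recurrence where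

  open Components using (EdgesBelow)
  open Gluing
  open CornerAbstraction using (acyclicGluing)
  open ForestKinds
  open Classification
  open FiniteSums using (module Sums)
  open import Level using (Level)
  open import Data.Nat using (ℕ; zero; suc)
  import Data.Nat as ℕ
  open import Data.Bool using (Bool; true; false; if_then_else_)
  open import Data.List using (List; []; _∷_; _++_; map; foldr)
  open import Data.List.Membership.Propositional using (_∈_)
  open import Data.List.Membership.Propositional.Properties using (∈-++⁻; ∈-map⁻)
  open import Data.List.Relation.Unary.Any using (here; there)
  open import Data.Maybe using (Maybe; just; nothing)
  open import Data.Vec using ([]; _∷_)
  open import Data.Fin using (#_)
  open import Data.Product using (_,_)
  open import Data.Sum using (inj₁; inj₂)
  open import Algebra.Bundles using (CommutativeSemiring)
  import Relation.Binary.PropositionalEquality as ≡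

  subsets-⊆ : ∀ {A : Set} (E : List A) {s} → s ∈ subsets E → ∀ {e} → e ∈ s → e ∈ E
  subsets-⊆ (x ∷ E) {s} s∈ e∈ with ∈-++⁻ (subsets E) s∈
  ... | inj₁ s∈E = there (subsets-⊆ E s∈E e∈)
  ... | inj₂ s∈xE with ∈-map⁻ (x ∷_) s∈xE
  ... | s′ , s′∈ , ≡.refl with e∈
  ... | here ≡.refl = here ≡.refl
  ... | there e∈′ = there (subsets-⊆ E s′∈ e∈′)
  subsets-⊆ [] (here ≡.refl) ()

  module _ {c ℓ : Level} (S : CommutativeSemiring c ℓ) where
    open CommutativeSemiring S
    open Sums S
    open import Relation.Binary.Reasoning.Setoid setoid
    open import Algebra.Solver.Ring.NaturalCoefficients.Default S

    env : (Maybe Kind → Carrier) → Env 6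
    env h = h (just kT) ∷ h (just kU) ∷ h (just kR) ∷ h (just kL) ∷ h (just kQ) ∷ h nothing ∷ []

    [_]ᴾ : Bool → Polynomial 6
    [ true ]ᴾ = con 1
    [ false ]ᴾ = con 0

    ∑ᴾ : List (Maybe Kind) → (Maybe Kind → Polynomial 6) → Polynomial 6
    ∑ᴾ [] f = con 0
    ∑ᴾ (t ∷ ts) f = f t :+ ∑ᴾ ts f

    deltaᴾ : Maybe Kind → Polynomial 6
    deltaᴾ m = ∑ᴾ kinds (λ t → [ sameKind m t ]ᴾ :* var (kindIndex t))

    -- Identities between sums over the six kinds are checked by normalising both sides as
    -- polynomials in the six values.
    select : ∀ m (h : Maybe Kind → Carrier) → ∑[ t ∈ kinds ] ([ sameKind m t ] * h t) ≈ h m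
    select (just kT) h = prove (env h) (deltaᴾ (just kT)) (var (# 0)) refl
    select (just kU) h = prove (env h) (deltaᴾ (just kU)) (var (# 1)) refl
    select (just kR) h = prove (env h) (deltaᴾ (just kR)) (var (# 2)) refl
    select (just kL) h = prove (env h) (deltaᴾ (just kL)) (var (# 3)) refl
    select (just kQ) h = prove (env h) (deltaᴾ (just kQ)) (var (# 4)) refl
    select nothing h = prove (env h) (deltaᴾ nothing) (var (# 5)) refl

    module ByKind {A : Set} (xs : List A) (kindOf : A → Maybe Kind) (w : A → Carrier) where

      W : Maybe Kind → Carrier
      W t = ∑[ s ∈ xs ] ([ sameKind (kindOf s) t ] * w s)

      ∑-by-kind : ∀ (f : Maybe Kind → Carrier) → ∑[ s ∈ xs ] (f (kindOf s) * w s) ≈ ∑[ t ∈ kinds ] (f t * W t)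
      ∑-by-kind f = begin
        ∑[ s ∈ xs ] (f (kindOf s) * w s)
          ≈⟨ ∑-cong xs (λ s → *-cong (sym (select (kindOf s) f)) refl) ⟩
        ∑[ s ∈ xs ] (∑[ t ∈ kinds ] ([ sameKind (kindOf s) t ] * f t) * w s)
          ≈⟨ ∑-cong xs (λ s → ∑-*ʳ kinds (λ t → [ sameKind (kindOf s) t ] * f t) (w s)) ⟩
        ∑[ s ∈ xs ] ∑[ t ∈ kinds ] ([ sameKind (kindOf s) t ] * f t * w s)
          ≈⟨ ∑-swap xs kinds (λ s t → [ sameKind (kindOf s) t ] * f t * w s) ⟩
        ∑[ t ∈ kinds ] ∑[ s ∈ xs ] ([ sameKind (kindOf s) t ] * f t * w s)
          ≈⟨ ∑-cong kinds (λ t → ∑-cong xs (λ s → swap-front ([ sameKind (kindOf s) t ]) (f t) (w s))) ⟩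
        ∑[ t ∈ kinds ] ∑[ s ∈ xs ] (f t * ([ sameKind (kindOf s) t ] * w s))
          ≈⟨ ∑-cong kinds (λ t → sym (∑-*ˡ xs (λ s → [ sameKind (kindOf s) t ] * w s) (f t))) ⟩
        ∑[ t ∈ kinds ] (f t * W t) ∎
        where
        swap-front : ∀ x y z → x * y * z ≈ y * (x * z)
        swap-front = solve 3 (λ x y z → x :* y :* z := y :* (x :* z)) refl

      ∑³-by-kind : ∀ (Φ : Maybe Kind → Maybe Kind → Maybe Kind → Carrier) →
        ∑[ x ∈ xs ] ∑[ y ∈ xs ] ∑[ z ∈ xs ] (Φ (kindOf x) (kindOf y) (kindOf z) * (w x * (w y * w z)))
          ≈ ∑[ α ∈ kinds ] ∑[ β ∈ kinds ] ∑[ δ ∈ kinds ] (Φ α β δ * (W α * (W β * W δ)))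
      ∑³-by-kind Φ = begin
        ∑[ x ∈ xs ] ∑[ y ∈ xs ] ∑[ z ∈ xs ] (Φ (kindOf x) (kindOf y) (kindOf z) * (w x * (w y * w z)))
          ≈⟨ ∑³-factor xs xs xs (λ x y z → Φ (kindOf x) (kindOf y) (kindOf z)) w w w ⟩
        ∑[ x ∈ xs ] (∑[ y ∈ xs ] (∑[ z ∈ xs ] (Φ (kindOf x) (kindOf y) (kindOf z) * w z) * w y) * w x)
          ≈⟨ ∑-cong xs (λ x → *-cong (∑-cong xs (λ y → *-cong (∑-by-kind (Φ (kindOf x) (kindOf y))) refl)) refl) ⟩
        ∑[ x ∈ xs ] (∑[ y ∈ xs ] (∑[ δ ∈ kinds ] (Φ (kindOf x) (kindOf y) δ * W δ) * w y) * w x)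
          ≈⟨ ∑-cong xs (λ x → *-cong (∑-by-kind (λ β → ∑[ δ ∈ kinds ] (Φ (kindOf x) β δ * W δ))) refl) ⟩
        ∑[ x ∈ xs ] (∑[ β ∈ kinds ] (∑[ δ ∈ kinds ] (Φ (kindOf x) β δ * W δ) * W β) * w x)
          ≈⟨ ∑-by-kind (λ α → ∑[ β ∈ kinds ] (∑[ δ ∈ kinds ] (Φ α β δ * W δ) * W β)) ⟩
        ∑[ α ∈ kinds ] (∑[ β ∈ kinds ] (∑[ δ ∈ kinds ] (Φ α β δ * W δ) * W β) * W α)
          ≈⟨ sym (∑³-factor kinds kinds kinds Φ W W W) ⟩
        ∑[ α ∈ kinds ] ∑[ β ∈ kinds ] ∑[ δ ∈ kinds ] (Φ α β δ * (W α * (W β * W δ))) ∎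

    ∑³ : (Maybe Kind → Maybe Kind → Maybe Kind → Carrier) → (Maybe Kind → Carrier) → Carrier
    ∑³ Φ V = ∑[ α ∈ kinds ] ∑[ β ∈ kinds ] ∑[ δ ∈ kinds ] (Φ α β δ * (V α * (V β * V δ)))

    ∑³-cong : ∀ Φ {V V′} → (∀ t → V t ≈ V′ t) → ∑³ Φ V ≈ ∑³ Φ V′
    ∑³-cong Φ {V} {V′} V≈ = ∑-cong kinds λ α → ∑-cong kinds λ β → ∑-cong kinds λ δ → term α β δ
      where
      term : ∀ α β δ → Φ α β δ * (V α * (V β * V δ)) ≈ Φ α β δ * (V′ α * (V′ β * V′ δ))
      term α β δ = *-congˡ (*-cong (V≈ α) (*-cong (V≈ β) (V≈ δ)))

    infixr 8 _×ᴾ_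

    _×ᴾ_ : ℕ → Polynomial 6 → Polynomial 6
    zero ×ᴾ p = con 0
    suc n ×ᴾ p = p :+ n ×ᴾ p

    recurrenceᴾ : Kind → Polynomial 6
    recurrenceᴾ kT = 2 ×ᴾ (T :* T :* (U :+ R :+ L))
      where T = var (# 0); U = var (# 1); R = var (# 2); L = var (# 3)
    recurrenceᴾ kU = T :* (3 ×ᴾ (L :* R) :+ U :* R :+ U :* L :+ 2 ×ᴾ (U :* U)) :+ T :* T :* Q
      where T = var (# 0); U = var (# 1); R = var (# 2); L = var (# 3); Q = var (# 4)
    recurrenceᴾ kR = T :* (3 ×ᴾ (U :* L) :+ U :* R :+ R :* L :+ 2 ×ᴾ (R :* R)) :+ T :* T :* Q
      where T = var (# 0); U = var (# 1); R = var (# 2); L = var (# 3); Q = var (# 4)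
    recurrenceᴾ kL = T :* (3 ×ᴾ (U :* R) :+ L :* U :+ R :* L :+ 2 ×ᴾ (L :* L)) :+ T :* T :* Q
      where T = var (# 0); U = var (# 1); R = var (# 2); L = var (# 3); Q = var (# 4)
    recurrenceᴾ kQ = 4 ×ᴾ (T :* Q :* (U :+ R :+ L))
                     :+ 2 ×ᴾ (U :* U :* (L :+ R) :+ R :* R :* (U :+ L) :+ L :* L :* (R :+ U))
                     :+ 2 ×ᴾ (U :* R :* L)
      where T = var (# 0); U = var (# 1); R = var (# 2); L = var (# 3); Q = var (# 4)

    admissibleᴾ : Kind → Polynomial 6
    admissibleᴾ κ = ∑ᴾ kinds λ α → ∑ᴾ kinds λ β → ∑ᴾ kinds λ δ →
      [ admissible κ α β δ ]ᴾ :* (var (kindIndex α) :* (var (kindIndex β) :* var (kindIndex δ)))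

    opaque
      unfolding acyclicGluing

      admissible-recurrence : ∀ κ V → ∑³ (λ α β δ → [ admissible κ α β δ ]) V ≈ ⟦ recurrenceᴾ κ ⟧ (env V)
      admissible-recurrence kT V = prove (env V) (admissibleᴾ kT) (recurrenceᴾ kT) refl
      admissible-recurrence kU V = prove (env V) (admissibleᴾ kU) (recurrenceᴾ kU) refl
      admissible-recurrence kR V = prove (env V) (admissibleᴾ kR) (recurrenceᴾ kR) refl
      admissible-recurrence kL V = prove (env V) (admissibleᴾ kL) (recurrenceᴾ kL) refl
      admissible-recurrence kQ V = prove (env V) (admissibleᴾ kQ) (recurrenceᴾ kQ) refl

    module Counts (a b c′ : Carrier) where
      open Gen S

      w : List Edge → Carrier
      w = weight a b c′

      genFun : Kind → Graph → Carrier
      genFun κ G = wsum a b c′ G (CountedBy κ (nv G))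

      values : Graph → Maybe Kind → Carrier
      values G (just κ) = genFun κ G
      values G nothing = 0#

      w-++ : ∀ xs ys → w (xs ++ ys) ≈ w xs * w ys
      w-++ [] ys = sym (*-identityˡ _)
      w-++ ((_ , _ , l) ∷ xs) ys = trans (*-congˡ (w-++ xs ys)) (sym (*-assoc _ _ _))

      w-map : ∀ f xs → w (map (mapEdge f) xs) ≡.≡ w xs
      w-map f [] = ≡.refl
      w-map f ((_ , _ , l) ∷ xs) = ≡.cong (wLabel a b c′ l *_) (w-map f xs)

      wsum-∑ : ∀ G p → wsum a b c′ G p ≈ ∑[ F ∈ subsets (edges G) ] ([ p F ] * w F)
      wsum-∑ G p = trans (reflexive (∑-foldr (subsets (edges G)) _)) (∑-cong (subsets (edges G)) if≈[])
        where
        if≈[] : ∀ F → (if p F then w F else 0#) ≈ [ p F ] * w F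
        if≈[] F with p F
        ... | true = sym (*-identityˡ _)
        ... | false = sym (zeroˡ _)

      module _ (k : ℕ) (E : List Edge) (below : EdgesBelow (3 ℕ.+ k) E) where
        open ByKind (subsets E) (kind (3 ℕ.+ k)) w

        G : Graph
        G = graph (3 ℕ.+ k) E

        W-genFun : ∀ κ → W (just κ) ≈ genFun κ G
        W-genFun κ = sym (trans (wsum-∑ G (CountedBy κ (3 ℕ.+ k)))
          (∑-cong (subsets E) (λ s → *-congʳ (reflexive (≡.cong [_] (CountedBy≡isKind κ k s))))))

        genFun-step : ∀ κ → genFun κ (step G) ≈ ∑³ (λ α β δ → [ admissible κ α β δ ]) W
        genFun-step κ = begin
          genFun κ (step G)
            ≈⟨ wsum-∑ (step G) counted ⟩
          ∑[ F ∈ subsets (map mX E ++ (map mY E ++ map mZ E)) ] f F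
            ≈⟨ ∑-subsets-++ (map mX E) _ f ⟩
          ∑[ s ∈ subsets (map mX E) ] ∑[ t ∈ subsets (map mY E ++ map mZ E) ] f (s ++ t)
            ≈⟨ ∑-cong (subsets (map mX E)) (λ s → ∑-subsets-++ (map mY E) (map mZ E) (λ t → f (s ++ t))) ⟩
          ∑[ s ∈ subsets (map mX E) ] ∑[ t ∈ subsets (map mY E) ] ∑[ u ∈ subsets (map mZ E) ] f (s ++ (t ++ u))
            ≈⟨ trans (∑-subsets-map mX E _) (∑-cong (subsets E) λ sX →
                 trans (∑-subsets-map mY E _) (∑-cong (subsets E) λ sY → ∑-subsets-map mZ E _)) ⟩
          ∑[ sX ∈ subsets E ] ∑[ sY ∈ subsets E ] ∑[ sZ ∈ subsets E ] f (glue k (sX , sY , sZ))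
            ≈⟨ ∑-cong∈ (subsets E) (λ sX∈ → ∑-cong∈ (subsets E) (λ sY∈ → ∑-cong∈ (subsets E) (λ sZ∈ → glued-term sX∈ sY∈ sZ∈))) ⟩
          ∑[ sX ∈ subsets E ] ∑[ sY ∈ subsets E ] ∑[ sZ ∈ subsets E ]
            ([ admissible κ (kind (3 ℕ.+ k) sX) (kind (3 ℕ.+ k) sY) (kind (3 ℕ.+ k) sZ) ] * (w sX * (w sY * w sZ)))
            ≈⟨ ∑³-by-kind (λ α β δ → [ admissible κ α β δ ]) ⟩
          ∑³ (λ α β δ → [ admissible κ α β δ ]) W ∎
          where
          mX mY mZ : Edge → Edge
          mX = mapEdge (embX k)
          mY = mapEdge (embY k)
          mZ = mapEdge (embZ k)
          counted = CountedBy κ (gluedSize k)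
          f : List Edge → Carrier
          f F = [ counted F ] * w F
          glued-term : ∀ {sX sY sZ} → sX ∈ subsets E → sY ∈ subsets E → sZ ∈ subsets E →
            f (glue k (sX , sY , sZ)) ≈ [ admissible κ (kind (3 ℕ.+ k) sX) (kind (3 ℕ.+ k) sY) (kind (3 ℕ.+ k) sZ) ] * (w sX * (w sY * w sZ))
          glued-term {sX} {sY} {sZ} sX∈ sY∈ sZ∈ =
            *-cong (reflexive (≡.cong [_] (CountedBy-glued k sX sY sZ below′ κ)))
              (trans (w-++ (map mX sX) _) (*-cong (reflexive (w-map (embX k) sX))
                (trans (w-++ (map mY sY) _) (*-cong (reflexive (w-map (embY k) sY)) (reflexive (w-map (embZ k) sZ))))))
            where
            below′ : PiecesBelow (3 ℕ.+ k) (sX , sY , sZ)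
            below′ X e∈ = below (subsets-⊆ E sX∈ e∈)
            below′ Y e∈ = below (subsets-⊆ E sY∈ e∈)
            below′ Z e∈ = below (subsets-⊆ E sZ∈ e∈)

        private
          V : Maybe Kind → Carrier
          V (just κ) = genFun κ G
          V nothing = W nothing

          W≈V : ∀ t → W t ≈ V t
          W≈V (just κ) = W-genFun κ
          W≈V nothing = refl

          unused-value-irrelevant : ∀ κ → ⟦ recurrenceᴾ κ ⟧ (env V) ≡.≡ ⟦ recurrenceᴾ κ ⟧ (env (values G))
          unused-value-irrelevant kT = ≡.refl
          unused-value-irrelevant kU = ≡.refl
          unused-value-irrelevant kR = ≡.refl
          unused-value-irrelevant kL = ≡.refl
          unused-value-irrelevant kQ = ≡.refl

        genFun-step-recurrence : ∀ κ → genFun κ (step G) ≈ ⟦ recurrenceᴾ κ ⟧ (env (values G))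
        genFun-step-recurrence κ = begin
          genFun κ (step G)                                     ≈⟨ genFun-step κ ⟩
          ∑³ (λ α β δ → [ admissible κ α β δ ]) W              ≈⟨ ∑³-cong (λ α β δ → [ admissible κ α β δ ]) W≈V ⟩
          ∑³ (λ α β δ → [ admissible κ α β δ ]) V              ≈⟨ admissible-recurrence κ V ⟩
          ⟦ recurrenceᴾ κ ⟧ (env V)                             ≡⟨ unused-value-irrelevant κ ⟩
          ⟦ recurrenceᴾ κ ⟧ (env (values G))                    ∎

      genFun-Γ-recurrence : ∀ n κ → genFun κ (Γ (suc (suc n))) ≈ ⟦ recurrenceᴾ κ ⟧ (env (values (Γ (suc n))))
      genFun-Γ-recurrence n κ with Γ-shape n
      ... | k , size , below =
        ≡.subst (λ m → genFun κ (step (graph m E)) ≈ ⟦ recurrenceᴾ κ ⟧ (env (values (graph m E))))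
                (≡.sym size) (genFun-step-recurrence k E below κ)
        where E = edges (Γ (suc n))

      labelᴾ : Label → Polynomial 3
      labelᴾ la = var (# 0)
      labelᴾ lb = var (# 1)
      labelᴾ lc = var (# 2)

      -- wsum with the weights kept symbolic, so that ⟦ wsumᴾ G p ⟧ computes to wsum a b c′ G p on a concrete graph.
      wsumᴾ : Graph → (List Edge → Bool) → Polynomial 3
      wsumᴾ G p = foldr (λ F r → (if p F then weightᴾ F else con 0) :+ r) (con 0) (subsets (edges G))
        where
        weightᴾ : List Edge → Polynomial 3
        weightᴾ = foldr (λ { (_ , _ , l) r → labelᴾ l :* r }) (con 1)

      initialᴾ : Kind → Polynomial 3
      initialᴾ kT = var (# 0) :* var (# 1) :+ var (# 0) :* var (# 2) :+ var (# 1) :* var (# 2)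
      initialᴾ kU = var (# 1)
      initialᴾ kR = var (# 0)
      initialᴾ kL = var (# 2)
      initialᴾ kQ = con 1

      genFun-Γ₁ : ∀ κ → genFun κ (Γ 1) ≈ ⟦ initialᴾ κ ⟧ (a ∷ b ∷ c′ ∷ [])
      genFun-Γ₁ kT = prove (a ∷ b ∷ c′ ∷ []) (wsumᴾ Γ₁ (CountedBy kT 3)) (initialᴾ kT) refl
      genFun-Γ₁ kU = prove (a ∷ b ∷ c′ ∷ []) (wsumᴾ Γ₁ (CountedBy kU 3)) (initialᴾ kU) refl
      genFun-Γ₁ kR = prove (a ∷ b ∷ c′ ∷ []) (wsumᴾ Γ₁ (CountedBy kR 3)) (initialᴾ kR) refl
      genFun-Γ₁ kL = prove (a ∷ b ∷ c′ ∷ []) (wsumᴾ Γ₁ (CountedBy kL 3)) (initialᴾ kL) refl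
      genFun-Γ₁ kQ = prove (a ∷ b ∷ c′ ∷ []) (wsumᴾ Γ₁ (CountedBy kQ 3)) (initialᴾ kQ) refl

open ForestKinds using (kT; kU; kR; kL; kQ)
open Recurrence using (module Counts)

theorem2p10 : {c ℓ : Level} (S : CommutativeSemiring c ℓ) →
    let open CommutativeSemiring S
        open Gen S
    in (a b c' : Carrier) →
       (T a b c' 1 ≈ a * b + a * c' + b * c')
       × (U a b c' 1 ≈ b) × (R a b c' 1 ≈ a) × (L a b c' 1 ≈ c') × (Q a b c' 1 ≈ 1#)
       × ((n : ℕ) →
          let Tn = T a b c' (suc n)
              Un = U a b c' (suc n)
              Rn = R a b c' (suc n)
              Ln = L a b c' (suc n)
              Qn = Q a b c' (suc n)
          in (T a b c' (suc (suc n)) ≈ 2 · (Tn * Tn * (Un + Rn + Ln)))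
             × (U a b c' (suc (suc n)) ≈ Tn * (3 · (Ln * Rn) + Un * Rn + Un * Ln + 2 · (Un * Un)) + Tn * Tn * Qn)
             × (R a b c' (suc (suc n)) ≈ Tn * (3 · (Un * Ln) + Un * Rn + Rn * Ln + 2 · (Rn * Rn)) + Tn * Tn * Qn)
             × (L a b c' (suc (suc n)) ≈ Tn * (3 · (Un * Rn) + Ln * Un + Rn * Ln + 2 · (Ln * Ln)) + Tn * Tn * Qn)
             × (Q a b c' (suc (suc n)) ≈ 4 · (Tn * Qn * (Un + Rn + Ln))
                  + 2 · (Un * Un * (Ln + Rn) + Rn * Rn * (Un + Ln) + Ln * Ln * (Rn + Un))
                  + 2 · (Un * Rn * Ln)))
theorem2p10 S a b c' =
  initial kT , initial kU , initial kR , initial kL , initial kQ ,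
  λ n → recurrence n kT , recurrence n kU , recurrence n kR , recurrence n kL , recurrence n kQ
  where
  open Counts S a b c' renaming (genFun-Γ₁ to initial; genFun-Γ-recurrence to recurrence)
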